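{- Let $\mathcal{H}$ be a finite graph with no induced cycle $C_k$ for every $k\geq 4$. Then $\mathcal{H}$ is a shortest path graph if and only if $\mathcal{H}$ is a tree of cliques.
   Context: All graphs are simple and finite. For a graph $G$ and distinct $a,b\in V(G)$, an $(a,b)$-geodesic is a shortest path from $a$ to $b$ in $G$. The shortest path graph $S(G,a,b)$ has as vertices the $(a,b)$-geodesics of $G$, two being adjacent iff their vertex sets differ in exactly one vertex. A graph is a shortest path graph (SPG) if it is isomorphic to $S(G,a,b)$ for some graph $G$ and distinct $a,b\in V(G)$. A graph is $H$-free if it has no induced subgraph isomorphic to $H$. A tree of cliques is a graph that is $C_k$-free for all $k\geq 4$, claw-free ($K_{1,3}$-free), and in which any two distinct maximal cliques share at most one vertex (it may be disconnected). -}

module Defs where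

open import Data.Nat using (ℕ; zero; suc; _≤_; _<_; _≡ᵇ_)
open import Data.Bool using (Bool; true; false; _∧_; _∨_)
open import Data.Fin using (Fin; toℕ; zero; suc)
open import Data.Fin.Subset using (Subset; _∈_; _∉_; _∩_; _∪_; ∁; ∣_∣; ⁅_⁆; ⊥)
open import Data.Vec using (Vec; []; _∷_; head; last; foldr′)
open import Data.Product using (Σ; _×_; _,_; ∃)
open import Relation.Binary.PropositionalEquality using (_≡_; _≢_)
open import Relation.Nullary using (¬_)
open import Function.Definitions using (Injective)

record Graph : Set where
  field
    V      : ℕ
    adj    : Fin V → Fin V → Bool
    adj-sym   : ∀ i j → adj i j ≡ adj j i
    adj-irrefl : ∀ i → adj i i ≡ false
open Graph public

HasInduced : (G : Graph) (k : ℕ) → (Fin k → Fin k → Bool) → Set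
HasInduced G k P =
  Σ (Fin k → Fin (V G)) λ f → Injective _≡_ _≡_ f × (∀ i j → adj G (f i) (f j) ≡ P i j)

-- adjacency of the cycle C_k on Fin k (i ~ i+1 mod k); a cycle for k ≥ 3
cycAdj : (k : ℕ) → Fin k → Fin k → Bool
cycAdj k i j =
  (suc (toℕ i) ≡ᵇ toℕ j) ∨ (suc (toℕ j) ≡ᵇ toℕ i)
  ∨ ((toℕ i ≡ᵇ 0) ∧ (suc (toℕ j) ≡ᵇ k))
  ∨ ((toℕ j ≡ᵇ 0) ∧ (suc (toℕ i) ≡ᵇ k))

clawAdj : Fin 4 → Fin 4 → Bool
clawAdj zero zero = false
clawAdj zero (suc _) = true
clawAdj (suc _) zero = true
clawAdj (suc _) (suc _) = false

CkFreeFrom4 : Graph → Set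
CkFreeFrom4 G = ∀ k → 4 ≤ k → ¬ HasInduced G k (cycAdj k)

ClawFree : Graph → Set
ClawFree G = ¬ HasInduced G 4 clawAdj

IsClique : (G : Graph) → Subset (V G) → Set
IsClique G S = ∀ u v → u ∈ S → v ∈ S → u ≢ v → adj G u v ≡ true

IsMaximalClique : (G : Graph) → Subset (V G) → Set
IsMaximalClique G S =
  IsClique G S × (∀ w → w ∉ S → ¬ (∀ u → u ∈ S → adj G w u ≡ true))

TreeOfCliques : Graph → Set
TreeOfCliques G =
  CkFreeFrom4 G × ClawFree G ×
  (∀ S T → IsMaximalClique G S → IsMaximalClique G T → S ≢ T → ∣ S ∩ T ∣ ≤ 1)

-- walks of length l from a to b, as vertex sequences of length l+1
IsWalk : (G : Graph) {l : ℕ} → Fin (V G) → Fin (V G) → Vec (Fin (V G)) (suc l) → Set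
IsWalk G a b w = head w ≡ a × last w ≡ b × Consec w
  where
  Consec : ∀ {m} → Vec (Fin (V G)) m → Set
  Consec [] = Data.Unit.⊤ where import Data.Unit
  Consec (x ∷ []) = Data.Unit.⊤ where import Data.Unit
  Consec (x ∷ y ∷ ys) = (adj G x y ≡ true) × Consec (y ∷ ys)

-- an (a,b)-geodesic: an a-b walk of length l such that no a-b walk is shorter
-- (such a walk is automatically a path)
IsGeodesic : (G : Graph) (a b : Fin (V G)) (l : ℕ) → Vec (Fin (V G)) (suc l) → Set
IsGeodesic G a b l w =
  IsWalk G a b w × (∀ l′ → l′ < l → (w′ : Vec (Fin (V G)) (suc l′)) → ¬ IsWalk G a b w′)

vset : ∀ {n m} → Vec (Fin n) m → Subset n
vset = foldr′ (λ x S → ⁅ x ⁆ ∪ S) ⊥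

-- the vertex type of S(G,a,b): geodesics of any length
GeoCarrier : Graph → Set
GeoCarrier G = Σ ℕ λ l → Vec (Fin (V G)) (suc l)

SPGAdj : (G : Graph) → GeoCarrier G → GeoCarrier G → Set
SPGAdj G (l , p) (l′ , q) =
  ∣ vset p ∩ ∁ (vset q) ∣ ≡ 1 × ∣ vset q ∩ ∁ (vset p) ∣ ≡ 1

IsoToSPG : (H G : Graph) (a b : Fin (V G)) → Set
IsoToSPG H G a b =
  Σ (Fin (V H) → GeoCarrier G) λ φ →
    (∀ i → IsGeodesic G a b (Data.Product.proj₁ (φ i)) (Data.Product.proj₂ (φ i)))
    × Injective _≡_ _≡_ φ
    × (∀ l w → IsGeodesic G a b l w → ∃ λ i → φ i ≡ (l , w))
    × (∀ i j → (adj H i j ≡ true → SPGAdj G (φ i) (φ j))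
                × (SPGAdj G (φ i) (φ j) → adj H i j ≡ true))

IsSPG : Graph → Set
IsSPG H = Σ Graph λ G → Σ (Fin (V G)) λ a → Σ (Fin (V G)) λ b → a ≢ b × IsoToSPG H G a b

-- (⇒)  Let H ≅ S(G,a,b).  All (a,b)-geodesics have the same length and a vertex
-- lies on two geodesics only at the same position, so two geodesics are adjacent
-- in S(G,a,b) iff they differ at exactly one position.  If neighbours x, z of c
-- differ from c at positions s, t with s + 1 < t, changing c at both positions
-- gives a geodesic r, and c x r z is an induced C4; since three pairwise
-- non-adjacent neighbours of c differ from it at three distinct positions, H is
-- claw-free.  All vertices of a clique through two adjacent geodesics differ from
-- them at one common position, so two maximal cliques sharing two vertices span a
-- single clique and coincide.
--
-- (⇐)  A tree of cliques is also diamond-free.  Every hole-free, claw-free,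
-- diamond-free graph has a rook labelling (ℓ , r) : V → ℕ × ℕ: an injective map
-- such that distinct u, v are adjacent iff ℓ u ≡ ℓ v or r u ≡ r v.  It is built
-- by induction on the number of vertices; adding a vertex may require exchanging
-- the two coordinates on a connected component, which is possible because no
-- hole passes through the new vertex.  From a rook labelling we build G with
-- vertices a, b, L_i, R_j and edges a L_i, R_j b, and L_i R_j whenever (i , j) is a
-- label; its (a,b)-geodesics are exactly a L_(ℓ v) R_(r v) b, so S(G,a,b) ≅ H.
module Submission where

open import Defs
open import Function.Bundles using (_⇔_; mk⇔; Equivalence)
open import Data.Nat using (ℕ; zero; suc; _+_; _≡ᵇ_; _∸_; _⊔_; _≤_; _<_; z≤n; s≤s; s≤s⁻¹; _≤?_; _<?_)
open import Data.Nat.Properties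
open import Data.Nat.Induction using (<-rec)
open import Data.Bool using (Bool; true; false; _∧_; _∨_; T; if_then_else_)
import Data.Bool.Properties as BoolP
open import Data.Fin using (Fin; zero; suc; toℕ; fromℕ<)
import Data.Fin as Fin
import Data.Fin.Properties as FinP
open import Data.Fin.Subset using (Subset; _∈_; _∉_; _∩_; _∪_; ∁; ∣_∣; ⁅_⁆; inside; outside; _⊆_)
open import Data.Fin.Subset.Properties
open import Data.Vec using (Vec; []; _∷_; last; here; there)
open import Data.Product using (_×_; _,_; ∃; proj₁; proj₂)
open import Data.Sum using (_⊎_; inj₁; inj₂) renaming (map to map⊎; swap to swap⊎)
open import Data.Unit using (tt)
open import Data.Empty using (⊥; ⊥-elim)
open import Relation.Binary.PropositionalEquality
open import Function using (case_of_)
open import Relation.Binary using (tri<; tri≈; tri>)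
open import Relation.Nullary using (¬_; yes; no; Dec)
open import Relation.Nullary.Decidable using (_×-dec_; ¬?; _→-dec_; decidable-stable)

true≢false : ¬ true ≡ false
true≢false ()

¬true⇒false : ∀ {b : Bool} → ¬ b ≡ true → b ≡ false
¬true⇒false {false} _ = refl
¬true⇒false {true} b≢true = ⊥-elim (b≢true refl)

-- k < m  and  m ≤ l  written additively, so that positions can be matched on.
<⇒+suc : ∀ {k m} → k < m → ∃ λ d → m ≡ k + suc d
<⇒+suc {k} k<m with m≤n⇒∃[o]m+o≡n k<m
... | d , eq = d , trans (sym eq) (sym (+-suc k d))

≤⇒+ : ∀ {m l} → m ≤ l → ∃ λ e → l ≡ m + e
≤⇒+ m≤l with m≤n⇒∃[o]m+o≡n m≤l
... | e , eq = e , sym eq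

+-swapʳ : ∀ x y z → x + y + z ≡ x + z + y
+-swapʳ x y z = begin
  x + y + z   ≡⟨ +-assoc x y z ⟩
  x + (y + z) ≡⟨ cong (x +_) (+-comm y z) ⟩
  x + (z + y) ≡⟨ +-assoc x z y ⟨
  x + z + y   ∎
  where open ≡-Reasoning

-- Vertex sequences are handled as functions ℕ → A; a vector of length l+1 is
-- read as such a function (constant beyond l), and conversely.

toFun : ∀ {A : Set} {l} → Vec A (suc l) → ℕ → A
toFun (x ∷ xs) zero = x
toFun {l = zero} (x ∷ []) (suc i) = x
toFun {l = suc l} (x ∷ xs) (suc i) = toFun xs i

fromFun : ∀ {A : Set} → (ℕ → A) → (l : ℕ) → Vec A (suc l)
fromFun f zero = f 0 ∷ []
fromFun f (suc l) = f 0 ∷ fromFun (λ i → f (suc i)) l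

toFun-fromFun : ∀ {A : Set} (f : ℕ → A) l i → i ≤ l → toFun (fromFun f l) i ≡ f i
toFun-fromFun f zero zero _ = refl
toFun-fromFun f (suc l) zero _ = refl
toFun-fromFun f (suc l) (suc i) (s≤s i≤l) = toFun-fromFun (λ j → f (suc j)) l i i≤l

toFun-last : ∀ {A : Set} {l} (w : Vec A (suc l)) → last w ≡ toFun w l
toFun-last (x ∷ []) = refl
toFun-last (x ∷ y ∷ ys) = toFun-last (y ∷ ys)

toFun-injective : ∀ {A : Set} {l} (w w′ : Vec A (suc l)) →
                  (∀ i → i ≤ l → toFun w i ≡ toFun w′ i) → w ≡ w′
toFun-injective (x ∷ []) (x′ ∷ []) agree = cong (_∷ []) (agree 0 z≤n)
toFun-injective (x ∷ y ∷ ys) (x′ ∷ y′ ∷ ys′) agree =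
  cong₂ _∷_ (agree 0 z≤n) (toFun-injective (y ∷ ys) (y′ ∷ ys′) (λ i i≤l → agree (suc i) (s≤s i≤l)))

vset⇒position : ∀ {n l} (w : Vec (Fin n) (suc l)) v → v ∈ vset w → ∃ λ i → i ≤ l × toFun w i ≡ v
vset⇒position (x ∷ []) v v∈ with x∈p∪q⁻ ⁅ x ⁆ _ v∈
... | inj₁ v∈x = 0 , z≤n , sym (x∈⁅y⁆⇒x≡y x v∈x)
... | inj₂ v∈∅ = ⊥-elim (∉⊥ v∈∅)
vset⇒position (x ∷ y ∷ ys) v v∈ with x∈p∪q⁻ ⁅ x ⁆ (vset (y ∷ ys)) v∈
... | inj₁ v∈x = 0 , z≤n , sym (x∈⁅y⁆⇒x≡y x v∈x)
... | inj₂ v∈ys with vset⇒position (y ∷ ys) v v∈ys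
...   | i , i≤l , eq = suc i , s≤s i≤l , eq

position⇒vset : ∀ {n l} (w : Vec (Fin n) (suc l)) i → i ≤ l → toFun w i ∈ vset w
position⇒vset (x ∷ []) zero _ = x∈p∪q⁺ (inj₁ (x∈⁅x⁆ x))
position⇒vset (x ∷ y ∷ ys) zero _ = x∈p∪q⁺ (inj₁ (x∈⁅x⁆ x))
position⇒vset (x ∷ y ∷ ys) (suc i) (s≤s i≤l) = x∈p∪q⁺ (inj₂ (position⇒vset (y ∷ ys) i i≤l))

nonempty⇒1≤∣p∣ : ∀ {n} {x : Fin n} (p : Subset n) → x ∈ p → 1 ≤ ∣ p ∣
nonempty⇒1≤∣p∣ (inside ∷ p) _ = s≤s z≤n
nonempty⇒1≤∣p∣ (outside ∷ p) (there x∈p) = nonempty⇒1≤∣p∣ p x∈p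

1≤∣p∣⇒nonempty : ∀ {n} (p : Subset n) → 1 ≤ ∣ p ∣ → ∃ λ x → x ∈ p
1≤∣p∣⇒nonempty (inside ∷ p) _ = zero , here
1≤∣p∣⇒nonempty (outside ∷ p) 1≤∣p∣ with 1≤∣p∣⇒nonempty p 1≤∣p∣
... | x , x∈p = suc x , there x∈p

two-elements⇒2≤∣p∣ : ∀ {n} {x y : Fin n} (p : Subset n) → x ∈ p → y ∈ p → x ≢ y → 2 ≤ ∣ p ∣
two-elements⇒2≤∣p∣ {x = zero} {zero} (inside ∷ p) _ _ x≢y = ⊥-elim (x≢y refl)
two-elements⇒2≤∣p∣ {x = zero} {suc y} (inside ∷ p) _ (there y∈p) _ = s≤s (nonempty⇒1≤∣p∣ p y∈p)
two-elements⇒2≤∣p∣ {x = suc x} (inside ∷ p) (there x∈p) _ _ = s≤s (nonempty⇒1≤∣p∣ p x∈p)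
two-elements⇒2≤∣p∣ (outside ∷ p) (there x∈p) (there y∈p) x≢y =
  two-elements⇒2≤∣p∣ p x∈p y∈p (λ eq → x≢y (cong suc eq))

2≤∣p∣⇒two-elements : ∀ {n} (p : Subset n) → 2 ≤ ∣ p ∣ → ∃ λ x → ∃ λ y → x ∈ p × y ∈ p × x ≢ y
2≤∣p∣⇒two-elements (inside ∷ p) (s≤s 1≤∣p∣) with 1≤∣p∣⇒nonempty p 1≤∣p∣
... | y , y∈p = zero , suc y , here , there y∈p , λ ()
2≤∣p∣⇒two-elements (outside ∷ p) 2≤∣p∣ with 2≤∣p∣⇒two-elements p 2≤∣p∣
... | x , y , x∈p , y∈p , x≢y = suc x , suc y , there x∈p , there y∈p , λ eq → x≢y (FinP.suc-injective eq)

∣p∣≡1⇒singleton : ∀ {n} (p : Subset n) → ∣ p ∣ ≡ 1 → ∃ λ x → x ∈ p × (∀ y → y ∈ p → y ≡ x)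
∣p∣≡1⇒singleton p size1 with 1≤∣p∣⇒nonempty p (≤-reflexive (sym size1))
... | x , x∈p = x , x∈p , unique
  where
  unique : ∀ y → y ∈ p → y ≡ x
  unique y y∈p with y Fin.≟ x
  ... | yes y≡x = y≡x
  ... | no y≢x = ⊥-elim (1+n≰n (subst (2 ≤_) size1 (two-elements⇒2≤∣p∣ p y∈p x∈p y≢x)))

singleton⇒∣p∣≡1 : ∀ {n} (p : Subset n) x → x ∈ p → (∀ y → y ∈ p → y ≡ x) → ∣ p ∣ ≡ 1
singleton⇒∣p∣≡1 p x x∈p unique = subst (λ q → ∣ q ∣ ≡ 1) p≡⁅x⁆ (∣⁅x⁆∣≡1 x)
  where
  p≡⁅x⁆ : ⁅ x ⁆ ≡ p
  p≡⁅x⁆ = ⊆-antisym (λ y∈⁅x⁆ → subst (_∈ p) (sym (x∈⁅y⁆⇒x≡y x y∈⁅x⁆)) x∈p)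
                    (λ {y} y∈p → subst (_∈ ⁅ x ⁆) (sym (unique y y∈p)) (x∈⁅x⁆ x))

module GraphFacts (G : Graph) where

  Vx : Set
  Vx = Fin (V G)

  adj-sym′ : ∀ {u v β} → adj G u v ≡ β → adj G v u ≡ β
  adj-sym′ {u} {v} eq = trans (adj-sym G v u) eq

  adj⇒≢ : ∀ {u v} → adj G u v ≡ true → u ≢ v
  adj⇒≢ {u} uv refl = true≢false (trans (sym uv) (adj-irrefl G u))

  adj-resp : ∀ {u v u′ v′} → u ≡ u′ → v ≡ v′ → adj G u v ≡ true → adj G u′ v′ ≡ true
  adj-resp refl refl uv = uv

  Steps : ℕ → (ℕ → Vx) → Set
  Steps m f = ∀ i → i < m → adj G (f i) (f (suc i)) ≡ true

  FunWalk : Vx → Vx → ℕ → (ℕ → Vx) → Set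
  FunWalk a b l f = f 0 ≡ a × f l ≡ b × Steps l f

  Steps-≤ : ∀ {m k} f → k ≤ m → Steps m f → Steps k f
  Steps-≤ f k≤m steps i i<k = steps i (<-≤-trans i<k k≤m)

  IsWalk⇒FunWalk : ∀ {l} (w : Vec Vx (suc l)) {a b} → IsWalk G a b w → FunWalk a b l (toFun w)
  IsWalk⇒FunWalk (x ∷ []) (start , end , _) = start , end , λ i ()
  IsWalk⇒FunWalk (x ∷ y ∷ ys) (start , end , (xy , rest))
    with IsWalk⇒FunWalk (y ∷ ys) (refl , refl , rest)
  ... | _ , _ , steps = start , trans (sym (toFun-last (y ∷ ys))) end , steps′
    where
    steps′ : Steps (suc _) (toFun (x ∷ y ∷ ys))
    steps′ zero _ = xy
    steps′ (suc i) (s≤s i<l) = steps i i<l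

  FunWalk⇒IsWalk : ∀ l (f : ℕ → Vx) {a b} → FunWalk a b l f → IsWalk G a b (fromFun f l)
  FunWalk⇒IsWalk zero f (start , end , _) = start , end , tt
  FunWalk⇒IsWalk (suc zero) f (start , end , steps) = start , end , (steps 0 (s≤s z≤n) , tt)
  FunWalk⇒IsWalk (suc (suc l)) f (start , end , steps)
    with FunWalk⇒IsWalk (suc l) (λ i → f (suc i)) (refl , end , λ i i<l → steps (suc i) (s≤s i<l))
  ... | _ , end′ , steps′ = start , end′ , (steps 0 (s≤s z≤n) , steps′)

  -- Splicing: follow f up to position k, then jump to position suc k + D of f′
  -- and continue along f′.  This is how walks are shortened throughout.
  splice : (f f′ : ℕ → Vx) (k D : ℕ) → ℕ → Vx
  splice f f′ k D i with i ≤? k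
  ... | yes _ = f i
  ... | no _ = f′ (i + D)

  splice-≤ : ∀ f f′ k D i → i ≤ k → splice f f′ k D i ≡ f i
  splice-≤ f f′ k D i i≤k with i ≤? k
  ... | yes _ = refl
  ... | no i≰k = ⊥-elim (i≰k i≤k)

  splice-> : ∀ f f′ k D i → k < i → splice f f′ k D i ≡ f′ (i + D)
  splice-> f f′ k D i k<i with i ≤? k
  ... | yes i≤k = ⊥-elim (<⇒≱ k<i i≤k)
  ... | no _ = refl

  splice-Steps : ∀ f f′ k D m → Steps k f → adj G (f k) (f′ (suc k + D)) ≡ true →
                 Steps (m + D) f′ → Steps m (splice f f′ k D)
  splice-Steps f f′ k D m steps jump steps′ i i<m with <-cmp i k
  ... | tri< i<k _ _ = adj-resp (sym (splice-≤ f f′ k D i (<⇒≤ i<k)))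
                                (sym (splice-≤ f f′ k D (suc i) i<k)) (steps i i<k)
  ... | tri≈ _ refl _ = adj-resp (sym (splice-≤ f f′ k D k ≤-refl))
                                 (sym (splice-> f f′ k D (suc k) ≤-refl)) jump
  ... | tri> _ _ k<i = adj-resp (sym (splice-> f f′ k D i k<i))
                                (sym (splice-> f f′ k D (suc i) (<-trans k<i (n<1+n i))))
                                (steps′ (i + D) (+-monoˡ-< D i<m))

  extend-Steps : ∀ f m w → Steps m f → adj G (f m) w ≡ true → Steps (suc m) (splice f (λ _ → w) m 0)
  extend-Steps f m w steps last-edge i (s≤s i≤m) with m≤n⇒m<n∨m≡n i≤m
  ... | inj₁ i<m = adj-resp (sym (splice-≤ f _ m 0 i i≤m)) (sym (splice-≤ f _ m 0 (suc i) i<m)) (steps i i<m)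
  ... | inj₂ refl = adj-resp (sym (splice-≤ f _ i 0 i ≤-refl)) (sym (splice-> f _ i 0 (suc i) ≤-refl)) last-edge

  crossing : ∀ (S : Vx → Bool) l f → S (f 0) ≡ true → S (f l) ≡ false → Steps l f →
             ∃ λ i → i < l × S (f i) ≡ true × S (f (suc i)) ≡ false
  crossing S zero f start end _ = ⊥-elim (true≢false (trans (sym start) end))
  crossing S (suc l) f start end steps with S (f 1) in S1
  ... | false = 0 , s≤s z≤n , start , S1
  ... | true with crossing S l (λ i → f (suc i)) S1 end (λ i i<l → steps (suc i) (s≤s i<l))
  ...   | i , i<l , in-S , out-S = suc i , s≤s i<l , in-S , out-S

  NoShorter : Vx → Vx → ℕ → Set
  NoShorter a b l = ∀ L → L < l → ∀ g → ¬ FunWalk a b L g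

  -- On two shortest a–b walks of the same length, a vertex cannot occur at a
  -- later position on the second walk: otherwise the first walk up to that vertex
  -- followed by the rest of the second would be shorter.
  shortest-no-later : ∀ {a b l} f f′ → FunWalk a b l f → FunWalk a b l f′ → NoShorter a b l →
                      ∀ k m → k < m → m ≤ l → f k ≡ f′ m → ⊥
  shortest-no-later {a} {b} f f′ (f0 , fl , steps) (_ , f′l , steps′) shortest k m k<m m≤l fk≡f′m
    with <⇒+suc k<m | ≤⇒+ m≤l
  ... | d , refl | zero , refl =
    shortest k (subst (k <_) (sym (+-identityʳ (k + suc d))) (m<m+n k (s≤s z≤n))) f
      (f0 , trans fk≡f′m (trans (cong f′ (sym (+-identityʳ _))) f′l) , Steps-≤ f (≤-trans (m≤m+n k (suc d)) (m≤m+n _ 0)) steps)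
  ... | d , refl | suc e , refl =
    shortest (k + suc e) shorter g
      (trans (splice-≤ f f′ k (suc d) 0 z≤n) f0 , g-end , g-steps)
    where
    l≡ : k + suc e + suc d ≡ k + suc d + suc e
    l≡ = +-swapʳ k (suc e) (suc d)
    shorter : k + suc e < k + suc d + suc e
    shorter = subst (k + suc e <_) l≡ (m<m+n (k + suc e) (s≤s z≤n))
    g : ℕ → Vx
    g = splice f f′ k (suc d)
    g-end : g (k + suc e) ≡ b
    g-end = trans (splice-> f f′ k (suc d) (k + suc e) (m<m+n k (s≤s z≤n))) (trans (cong f′ l≡) f′l)
    g-steps : Steps (k + suc e) g
    g-steps = splice-Steps f f′ k (suc d) (k + suc e)
                (Steps-≤ f (≤-trans (m≤m+n k (suc d)) (m≤m+n _ (suc e))) steps)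
                (adj-resp (sym fk≡f′m) refl (steps′ (k + suc d) (m<m+n _ (s≤s z≤n))))
                (subst (λ L → Steps L f′) (sym l≡) steps′)

module Geodesics (G : Graph) (a b : Fin (V G)) where
  open GraphFacts G

  len : GeoCarrier G → ℕ
  len = proj₁

  at : GeoCarrier G → ℕ → Vx
  at p = toFun (proj₂ p)

  IsGeo : GeoCarrier G → Set
  IsGeo p = IsGeodesic G a b (len p) (proj₂ p)

  geo⇒walk : ∀ p → IsGeo p → FunWalk a b (len p) (at p)
  geo⇒walk (l , w) (walk , _) = IsWalk⇒FunWalk w walk

  geo⇒shortest : ∀ p → IsGeo p → NoShorter a b (len p)
  geo⇒shortest (l , w) (_ , shortest) L L<l g walk = shortest L L<l (fromFun g L) (FunWalk⇒IsWalk L g walk)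

  same-length : ∀ p q → IsGeo p → IsGeo q → len p ≡ len q
  same-length p q gp gq with <-cmp (len p) (len q)
  ... | tri< p<q _ _ = ⊥-elim (geo⇒shortest q gq (len p) p<q (at p) (geo⇒walk p gp))
  ... | tri≈ _ p≡q _ = p≡q
  ... | tri> _ _ q<p = ⊥-elim (geo⇒shortest p gp (len q) q<p (at q) (geo⇒walk q gq))

  same-position : ∀ p q → IsGeo p → IsGeo q → ∀ k m → k ≤ len p → m ≤ len q → at p k ≡ at q m → k ≡ m
  same-position p q gp gq k m k≤ m≤ eq with <-cmp k m
  ... | tri< k<m _ _ = ⊥-elim (shortest-no-later (at p) (at q) (geo⇒walk p gp)
        (subst (λ L → FunWalk a b L (at q)) (sym (same-length p q gp gq)) (geo⇒walk q gq))
        (geo⇒shortest p gp) k m k<m (subst (m ≤_) (sym (same-length p q gp gq)) m≤) eq)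
  ... | tri≈ _ k≡m _ = k≡m
  ... | tri> _ _ m<k = ⊥-elim (shortest-no-later (at q) (at p) (geo⇒walk q gq)
        (subst (λ L → FunWalk a b L (at p)) (same-length p q gp gq) (geo⇒walk p gp))
        (geo⇒shortest q gq) m k m<k (subst (k ≤_) (same-length p q gp gq) k≤) (sym eq))

  GeoCarrier-ext : ∀ p q → len p ≡ len q → (∀ i → i ≤ len p → at p i ≡ at q i) → p ≡ q
  GeoCarrier-ext (l , w) (.l , w′) refl agree = cong (l ,_) (toFun-injective w w′ agree)

  DiffersOnlyAt : GeoCarrier G → GeoCarrier G → ℕ → Set
  DiffersOnlyAt p q k = k ≤ len p × at p k ≢ at q k × (∀ j → j ≤ len p → j ≢ k → at p j ≡ at q j)

  OneDiff : GeoCarrier G → GeoCarrier G → Set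
  OneDiff p q = ∃ (DiffersOnlyAt p q)

  OneDiff-sym : ∀ p q → len p ≡ len q → OneDiff p q → OneDiff q p
  OneDiff-sym p q p≡q (k , k≤ , differ , agree) =
    k , subst (k ≤_) p≡q k≤ , (λ eq → differ (sym eq)) ,
    λ j j≤ j≢k → sym (agree j (subst (j ≤_) (sym p≡q) j≤) j≢k)

  -- Because of same-position, the vertex at position k of p is missing from q
  -- exactly when p and q differ at k.
  ∉⇒differ : ∀ p q → IsGeo p → IsGeo q → ∀ k → k ≤ len p → at p k ∉ vset (proj₂ q) → at p k ≢ at q k
  ∉⇒differ p q gp gq k k≤ ∉q eq =
    ∉q (subst (_∈ vset (proj₂ q)) (sym eq) (position⇒vset (proj₂ q) k (subst (k ≤_) (same-length p q gp gq) k≤)))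

  differ⇒∉ : ∀ p q → IsGeo p → IsGeo q → ∀ k → k ≤ len p → at p k ≢ at q k → at p k ∉ vset (proj₂ q)
  differ⇒∉ p q gp gq k k≤ differ ∈q with vset⇒position (proj₂ q) (at p k) ∈q
  ... | j , j≤ , eq with same-position p q gp gq k j k≤ j≤ (sym eq)
  ... | refl = differ (sym eq)

  private
    Missing : GeoCarrier G → GeoCarrier G → Subset (V G)
    Missing p q = vset (proj₂ p) ∩ ∁ (vset (proj₂ q))

  one-missing⇒OneDiff : ∀ p q → IsGeo p → IsGeo q → ∣ Missing p q ∣ ≡ 1 → OneDiff p q
  one-missing⇒OneDiff p q gp gq size1 with ∣p∣≡1⇒singleton _ size1
  ... | x , x∈ , unique with x∈p∩q⁻ (vset (proj₂ p)) (∁ (vset (proj₂ q))) x∈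
  ... | x∈p , x∉q with vset⇒position (proj₂ p) x x∈p
  ... | k , k≤ , refl = k , k≤ , ∉⇒differ p q gp gq k k≤ (x∈∁p⇒x∉p x∉q) , agree
    where
    agree : ∀ j → j ≤ len p → j ≢ k → at p j ≡ at q j
    agree j j≤ j≢k with at p j Fin.≟ at q j
    ... | yes eq = eq
    ... | no differ = ⊥-elim (j≢k (same-position p p gp gp j k j≤ k≤ (unique (at p j)
            (x∈p∩q⁺ (position⇒vset (proj₂ p) j j≤ , x∉p⇒x∈∁p (differ⇒∉ p q gp gq j j≤ differ))))))

  OneDiff⇒one-missing : ∀ p q → IsGeo p → IsGeo q → OneDiff p q → ∣ Missing p q ∣ ≡ 1
  OneDiff⇒one-missing p q gp gq (k , k≤ , differ , agree) =
    singleton⇒∣p∣≡1 _ (at p k) (x∈p∩q⁺ (position⇒vset (proj₂ p) k k≤ , x∉p⇒x∈∁p (differ⇒∉ p q gp gq k k≤ differ))) unique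
    where
    unique : ∀ y → y ∈ Missing p q → y ≡ at p k
    unique y y∈ with x∈p∩q⁻ (vset (proj₂ p)) (∁ (vset (proj₂ q))) y∈
    ... | y∈p , y∉q with vset⇒position (proj₂ p) y y∈p
    ... | j , j≤ , refl with j ≟ k
    ... | yes refl = refl
    ... | no j≢k = ⊥-elim (∉⇒differ p q gp gq j j≤ (x∈∁p⇒x∉p y∉q) (agree j j≤ j≢k))

  SPGAdj⇒OneDiff : ∀ p q → IsGeo p → IsGeo q → SPGAdj G p q → OneDiff p q
  SPGAdj⇒OneDiff (l , w) (l′ , w′) gp gq (p-q , _) = one-missing⇒OneDiff (l , w) (l′ , w′) gp gq p-q

  OneDiff⇒SPGAdj : ∀ p q → IsGeo p → IsGeo q → OneDiff p q → SPGAdj G p q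
  OneDiff⇒SPGAdj (l , w) (l′ , w′) gp gq od =
    OneDiff⇒one-missing (l , w) (l′ , w′) gp gq od ,
    OneDiff⇒one-missing (l′ , w′) (l , w) gq gp (OneDiff-sym (l , w) (l′ , w′) (same-length (l , w) (l′ , w′) gp gq) od)

  swapIn : GeoCarrier G → GeoCarrier G → ℕ → ℕ → Vx
  swapIn X Z s i with i ≟ s
  ... | yes _ = at X s
  ... | no _ = at Z i

  swapIn-at-s : ∀ X Z s → swapIn X Z s s ≡ at X s
  swapIn-at-s X Z s with s ≟ s
  ... | yes _ = refl
  ... | no s≢s = ⊥-elim (s≢s refl)

  swapIn-off-s : ∀ X Z s i → i ≢ s → swapIn X Z s i ≡ at Z i
  swapIn-off-s X Z s i i≢s with i ≟ s
  ... | yes i≡s = ⊥-elim (i≢s i≡s)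
  ... | no _ = refl

  swapIn-geo : ∀ X Z s → IsGeo X → IsGeo Z →
               (∀ j → j ≤ len Z → suc j ≡ s ⊎ j ≡ suc s → at X j ≡ at Z j) →
               IsGeo (len Z , fromFun (swapIn X Z s) (len Z))
  swapIn-geo X Z s gX gZ near = FunWalk⇒IsWalk (len Z) g (start , end , steps) , proj₂ gZ
    where
    g = swapIn X Z s
    X-walk = subst (λ L → FunWalk a b L (at X)) (same-length X Z gX gZ) (geo⇒walk X gX)
    Z-walk = geo⇒walk Z gZ
    start : g 0 ≡ a
    start with 0 ≟ s
    ... | yes refl = proj₁ X-walk
    ... | no _ = proj₁ Z-walk
    end : g (len Z) ≡ b
    end with len Z ≟ s
    ... | yes refl = proj₁ (proj₂ X-walk)
    ... | no _ = proj₁ (proj₂ Z-walk)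
    steps : Steps (len Z) g
    steps i i< = step i i< (i ≟ s) (suc i ≟ s)
      where
      step : ∀ i → i < len Z → Dec (i ≡ s) → Dec (suc i ≡ s) → adj G (g i) (g (suc i)) ≡ true
      step i i< (yes refl) _ =
        adj-resp (sym (swapIn-at-s X Z i))
                 (trans (near (suc i) i< (inj₂ refl)) (sym (swapIn-off-s X Z i (suc i) 1+n≢n)))
                 (proj₂ (proj₂ X-walk) i i<)
      step i i< (no i≢s) (yes refl) =
        adj-resp (trans (near i (<⇒≤ i<) (inj₁ refl)) (sym (swapIn-off-s X Z (suc i) i i≢s)))
                 (sym (swapIn-at-s X Z (suc i)))
                 (proj₂ (proj₂ X-walk) i i<)
      step i i< (no i≢s) (no i+1≢s) =
        adj-resp (sym (swapIn-off-s X Z s i i≢s)) (sym (swapIn-off-s X Z s (suc i) i+1≢s))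
                 (proj₂ (proj₂ Z-walk) i i<)

≡ᵇ-refl : ∀ x → (x ≡ᵇ x) ≡ true
≡ᵇ-refl zero = refl
≡ᵇ-refl (suc x) = ≡ᵇ-refl x

≢⇒≡ᵇ-false : ∀ x y → x ≢ y → (x ≡ᵇ y) ≡ false
≢⇒≡ᵇ-false zero zero x≢y = ⊥-elim (x≢y refl)
≢⇒≡ᵇ-false zero (suc y) _ = refl
≢⇒≡ᵇ-false (suc x) zero _ = refl
≢⇒≡ᵇ-false (suc x) (suc y) x≢y = ≢⇒≡ᵇ-false x y (λ eq → x≢y (cong suc eq))

≡ᵇ-sound : ∀ x y → (x ≡ᵇ y) ≡ true → x ≡ y
≡ᵇ-sound x y eq = ≡ᵇ⇒≡ x y (subst T (sym eq) tt)

≡ᵇ-complete : ∀ {x y} → x ≡ y → (x ≡ᵇ y) ≡ true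
≡ᵇ-complete {x} refl = ≡ᵇ-refl x

-- An induced path p 0 , … , p m together with a further vertex z adjacent
-- exactly to its two ends is an induced cycle of length m + 2 (a hole if m ≥ 2).
module PathAndApex (H : Graph) (z : Fin (V H)) (p : ℕ → Fin (V H)) (m : ℕ)
  (z∉p : ∀ i → i ≤ m → z ≢ p i)
  (p-distinct : ∀ i j → i < j → j ≤ m → p i ≢ p j)
  (p-edge : ∀ i → i < m → adj H (p i) (p (suc i)) ≡ true)
  (p-chordless : ∀ i j → suc i < j → j ≤ m → adj H (p i) (p j) ≡ false)
  (z-start : adj H z (p 0) ≡ true) (z-end : adj H z (p m) ≡ true)
  (z-inner : ∀ i → 0 < i → i < m → adj H z (p i) ≡ false) where
  open GraphFacts H

  cycle : ℕ → Fin (V H)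
  cycle zero = z
  cycle (suc i) = p i

  cyc : ℕ → ℕ → ℕ → Bool
  cyc k i j = (suc i ≡ᵇ j) ∨ (suc j ≡ᵇ i) ∨ ((i ≡ᵇ 0) ∧ (suc j ≡ᵇ k)) ∨ ((j ≡ᵇ 0) ∧ (suc i ≡ᵇ k))

  path-table : ∀ i j → i ≤ m → j ≤ m → adj H (p i) (p j) ≡ (suc i ≡ᵇ j) ∨ ((suc j ≡ᵇ i) ∨ false)
  path-table i j i≤ j≤ with <-cmp i j
  ... | tri≈ _ refl _ rewrite ≢⇒≡ᵇ-false (suc i) i 1+n≢n = adj-irrefl H (p i)
  ... | tri< i<j _ _ with m≤n⇒m<n∨m≡n i<j
  ...   | inj₂ refl rewrite ≡ᵇ-refl (suc i) = p-edge i (<-≤-trans (n<1+n i) j≤)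
  ...   | inj₁ i+1<j rewrite ≢⇒≡ᵇ-false (suc i) j (<⇒≢ i+1<j)
                           | ≢⇒≡ᵇ-false (suc j) i (λ eq → <⇒≱ i<j (≤-trans (n≤1+n j) (≤-reflexive eq)))
                           = p-chordless i j i+1<j j≤
  path-table i j i≤ j≤ | tri> _ _ j<i with m≤n⇒m<n∨m≡n j<i
  ...   | inj₂ refl rewrite ≢⇒≡ᵇ-false (suc (suc j)) j (λ eq → <⇒≢ (<-trans (n<1+n j) (n<1+n (suc j))) (sym eq))
                          | ≡ᵇ-refl (suc j) = adj-sym′ (p-edge j (<-≤-trans (n<1+n j) i≤))
  ...   | inj₁ j+1<i rewrite ≢⇒≡ᵇ-false (suc i) j (λ eq → <⇒≱ j<i (≤-trans (n≤1+n i) (≤-reflexive eq)))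
                           | ≢⇒≡ᵇ-false (suc j) i (<⇒≢ j+1<i)
                           = adj-sym′ (p-chordless j i j+1<i i≤)

  cycle-table : ∀ i j → i ≤ suc m → j ≤ suc m → adj H (cycle i) (cycle j) ≡ cyc (suc (suc m)) i j
  cycle-table zero zero _ _ = adj-irrefl H z
  cycle-table zero (suc j) _ (s≤s j≤) = apex-row j j≤
    where
    apex-row : ∀ j → j ≤ m → adj H z (p j) ≡ (0 ≡ᵇ j) ∨ (false ∨ ((j ≡ᵇ m) ∨ false))
    apex-row zero _ = z-start
    apex-row (suc j) j≤ with suc j ≟ m
    ... | yes refl rewrite ≡ᵇ-refl (suc j) = z-end
    ... | no j≢m rewrite ≢⇒≡ᵇ-false (suc j) m j≢m = z-inner (suc j) (s≤s z≤n) (≤∧≢⇒< j≤ j≢m)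
  cycle-table (suc i) zero (s≤s i≤) _ =
    trans (adj-sym H (p i) z) (trans (cycle-table zero (suc i) z≤n (s≤s i≤)) (reorder (0 ≡ᵇ i) (i ≡ᵇ m)))
    where
    reorder : ∀ x y → x ∨ (false ∨ (y ∨ false)) ≡ false ∨ (x ∨ (false ∨ (true ∧ y)))
    reorder false false = refl
    reorder false true = refl
    reorder true y = refl
  cycle-table (suc i) (suc j) (s≤s i≤) (s≤s j≤) = path-table i j i≤ j≤

  cycle-injective : ∀ i j → i ≤ suc m → j ≤ suc m → cycle i ≡ cycle j → i ≡ j
  cycle-injective zero zero _ _ _ = refl
  cycle-injective zero (suc j) _ (s≤s j≤) eq = ⊥-elim (z∉p j j≤ eq)
  cycle-injective (suc i) zero (s≤s i≤) _ eq = ⊥-elim (z∉p i i≤ (sym eq))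
  cycle-injective (suc i) (suc j) (s≤s i≤) (s≤s j≤) eq with <-cmp i j
  ... | tri< i<j _ _ = ⊥-elim (p-distinct i j i<j j≤ eq)
  ... | tri≈ _ refl _ = refl
  ... | tri> _ _ j<i = ⊥-elim (p-distinct j i j<i i≤ (sym eq))

  induced-cycle : HasInduced H (suc (suc m)) (cycAdj (suc (suc m)))
  induced-cycle = (λ i → cycle (toℕ i)) ,
                  (λ {i} {j} eq → FinP.toℕ-injective (cycle-injective (toℕ i) (toℕ j) (bound i) (bound j) eq)) ,
                  λ i j → cycle-table (toℕ i) (toℕ j) (bound i) (bound j)
    where
    bound : (i : Fin (suc (suc m))) → toℕ i ≤ suc m
    bound i = s≤s⁻¹ (FinP.toℕ<n i)

three-spread : ∀ (K : Fin 3 → ℕ) → (∀ u w → u ≢ w → K u ≢ K w) → ∃ λ u → ∃ λ w → suc (K u) < K w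
three-spread K distinct with <-cmp (K k0) (K k1) | <-cmp (K k1) (K k2) | <-cmp (K k0) (K k2)
  where
  k0 k1 k2 : Fin 3
  k0 = zero
  k1 = suc zero
  k2 = suc (suc zero)
... | tri≈ _ eq _ | _ | _ = ⊥-elim (distinct zero (suc zero) (λ ()) eq)
... | _ | tri≈ _ eq _ | _ = ⊥-elim (distinct (suc zero) (suc (suc zero)) (λ ()) eq)
... | _ | _ | tri≈ _ eq _ = ⊥-elim (distinct zero (suc (suc zero)) (λ ()) eq)
... | tri< 0<1 _ _ | tri< 1<2 _ _ | _ = zero , suc (suc zero) , ≤-<-trans 0<1 1<2
... | tri< _ _ _ | tri> _ _ 2<1 | tri< 0<2 _ _ = zero , suc zero , ≤-<-trans 0<2 2<1
... | tri< 0<1 _ _ | tri> _ _ _ | tri> _ _ 2<0 = suc (suc zero) , suc zero , ≤-<-trans 2<0 0<1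
... | tri> _ _ 1<0 | tri< _ _ _ | tri< 0<2 _ _ = suc zero , suc (suc zero) , ≤-<-trans 1<0 0<2
... | tri> _ _ _ | tri< 1<2 _ _ | tri> _ _ 2<0 = suc zero , zero , ≤-<-trans 1<2 2<0
... | tri> _ _ 1<0 | tri> _ _ 2<1 | _ = suc (suc zero) , zero , ≤-<-trans 2<1 1<0

induced-C4 : ∀ (H : Graph) {c x r z} → adj H c x ≡ true → adj H x r ≡ true → adj H r z ≡ true → adj H z c ≡ true →
             adj H c r ≡ false → adj H x z ≡ false → c ≢ r → x ≢ z → HasInduced H 4 (cycAdj 4)
induced-C4 H {c} {x} {r} {z} cx xr rz zc c≁r x≁z c≢r x≢z =
  PathAndApex.induced-cycle H c path 2 apex∉path distinct edge chordless cx (adj-sym′ zc) inner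
  where
  open GraphFacts H
  path : ℕ → Fin (V H)
  path zero = x
  path (suc zero) = r
  path (suc (suc _)) = z
  apex∉path : ∀ i → i ≤ 2 → c ≢ path i
  apex∉path zero _ = adj⇒≢ cx
  apex∉path (suc zero) _ = c≢r
  apex∉path (suc (suc zero)) _ = λ c≡z → adj⇒≢ zc (sym c≡z)
  apex∉path (suc (suc (suc _))) (s≤s (s≤s ()))
  distinct : ∀ i j → i < j → j ≤ 2 → path i ≢ path j
  distinct zero (suc zero) _ _ = adj⇒≢ xr
  distinct zero (suc (suc zero)) _ _ = x≢z
  distinct (suc zero) (suc (suc zero)) _ _ = adj⇒≢ rz
  distinct (suc (suc _)) (suc (suc zero)) (s≤s (s≤s ())) _
  distinct (suc zero) (suc zero) (s≤s ()) _
  distinct _ (suc (suc (suc _))) _ (s≤s (s≤s ()))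
  edge : ∀ i → i < 2 → adj H (path i) (path (suc i)) ≡ true
  edge zero _ = xr
  edge (suc zero) _ = rz
  edge (suc (suc _)) (s≤s (s≤s ()))
  chordless : ∀ i j → suc i < j → j ≤ 2 → adj H (path i) (path j) ≡ false
  chordless zero (suc (suc zero)) _ _ = x≁z
  chordless zero (suc zero) (s≤s ()) _
  chordless (suc _) (suc (suc zero)) (s≤s (s≤s ())) _
  chordless _ (suc (suc (suc _))) _ (s≤s (s≤s ()))
  inner : ∀ i → 0 < i → i < 2 → adj H c (path i) ≡ false
  inner (suc zero) _ _ = c≁r
  inner (suc (suc _)) _ (s≤s (s≤s ()))

table⇒induced : ∀ (H : Graph) {k} (P : Fin k → Fin k → Bool) (f : Fin k → Fin (V H)) →
                (∀ i j → adj H (f i) (f j) ≡ P i j) → (∀ i j → i ≢ j → P i j ≡ false → f i ≢ f j) →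
                HasInduced H k P
table⇒induced H P f table separate = f , injective , table
  where
  injective : ∀ {i j} → f i ≡ f j → i ≡ j
  injective {i} {j} fi≡fj with i Fin.≟ j | P i j in Pij
  ... | yes i≡j | _ = i≡j
  ... | no i≢j | false = ⊥-elim (separate i j i≢j Pij fi≡fj)
  ... | no i≢j | true = ⊥-elim (GraphFacts.adj⇒≢ H (trans (table i j) Pij) fi≡fj)

induced-claw : ∀ (H : Graph) {c x y z} → adj H c x ≡ true → adj H c y ≡ true → adj H c z ≡ true →
               adj H x y ≡ false → adj H y z ≡ false → adj H x z ≡ false → x ≢ y → y ≢ z → x ≢ z →
               HasInduced H 4 clawAdj
induced-claw H {c} {x} {y} {z} cx cy cz x≁y y≁z x≁z x≢y y≢z x≢z = table⇒induced H clawAdj f table separate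
  where
  open GraphFacts H
  f : Fin 4 → Fin (V H)
  f zero = c
  f (suc zero) = x
  f (suc (suc zero)) = y
  f (suc (suc (suc zero))) = z
  table : ∀ i j → adj H (f i) (f j) ≡ clawAdj i j
  table zero zero = adj-irrefl H c
  table zero (suc zero) = cx
  table zero (suc (suc zero)) = cy
  table zero (suc (suc (suc zero))) = cz
  table (suc zero) zero = adj-sym′ cx
  table (suc zero) (suc zero) = adj-irrefl H x
  table (suc zero) (suc (suc zero)) = x≁y
  table (suc zero) (suc (suc (suc zero))) = x≁z
  table (suc (suc zero)) zero = adj-sym′ cy
  table (suc (suc zero)) (suc zero) = adj-sym′ x≁y
  table (suc (suc zero)) (suc (suc zero)) = adj-irrefl H y
  table (suc (suc zero)) (suc (suc (suc zero))) = y≁z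
  table (suc (suc (suc zero))) zero = adj-sym′ cz
  table (suc (suc (suc zero))) (suc zero) = adj-sym′ x≁z
  table (suc (suc (suc zero))) (suc (suc zero)) = adj-sym′ y≁z
  table (suc (suc (suc zero))) (suc (suc (suc zero))) = adj-irrefl H z
  separate : ∀ i j → i ≢ j → clawAdj i j ≡ false → f i ≢ f j
  separate zero zero i≢j _ = ⊥-elim (i≢j refl)
  separate (suc i) (suc j) i≢j _ = leaves i j (λ eq → i≢j (cong suc eq))
    where
    leaves : ∀ i j → i ≢ j → f (suc i) ≢ f (suc j)
    leaves zero (suc zero) _ = x≢y
    leaves zero (suc (suc zero)) _ = x≢z
    leaves (suc zero) zero _ = λ eq → x≢y (sym eq)
    leaves (suc zero) (suc (suc zero)) _ = y≢z
    leaves (suc (suc zero)) zero _ = λ eq → x≢z (sym eq)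
    leaves (suc (suc zero)) (suc zero) _ = λ eq → y≢z (sym eq)
    leaves zero zero i≢j = ⊥-elim (i≢j refl)
    leaves (suc zero) (suc zero) i≢j = ⊥-elim (i≢j refl)
    leaves (suc (suc zero)) (suc (suc zero)) i≢j = ⊥-elim (i≢j refl)

module FromSPG (H G : Graph) (a b : Fin (V G)) (iso : IsoToSPG H G a b) where
  open Geodesics G a b
  open GraphFacts H using (adj-sym′)

  φ : Fin (V H) → GeoCarrier G
  φ = proj₁ iso

  φ-geo : ∀ i → IsGeo (φ i)
  φ-geo = proj₁ (proj₂ iso)

  φ-injective : ∀ {i j} → φ i ≡ φ j → i ≡ j
  φ-injective = proj₁ (proj₂ (proj₂ iso))

  φ-onto : ∀ l w → IsGeodesic G a b l w → ∃ λ i → φ i ≡ (l , w)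
  φ-onto = proj₁ (proj₂ (proj₂ (proj₂ iso)))

  adj⇒OneDiff : ∀ i j → adj H i j ≡ true → OneDiff (φ i) (φ j)
  adj⇒OneDiff i j ij = SPGAdj⇒OneDiff (φ i) (φ j) (φ-geo i) (φ-geo j) (proj₁ (proj₂ (proj₂ (proj₂ (proj₂ iso))) i j) ij)

  OneDiff⇒adj : ∀ i j → OneDiff (φ i) (φ j) → adj H i j ≡ true
  OneDiff⇒adj i j od = proj₂ (proj₂ (proj₂ (proj₂ (proj₂ iso))) i j) (OneDiff⇒SPGAdj (φ i) (φ j) (φ-geo i) (φ-geo j) od)

  len-φ : ∀ i j → len (φ i) ≡ len (φ j)
  len-φ i j = same-length (φ i) (φ j) (φ-geo i) (φ-geo j)

  two-differences⇒¬OneDiff : ∀ p q k m → k ≢ m → k ≤ len p → m ≤ len p →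
                             at p k ≢ at q k → at p m ≢ at q m → ¬ OneDiff p q
  two-differences⇒¬OneDiff p q k m k≢m k≤ m≤ differ-k differ-m (r , _ , _ , agree) with k ≟ r | m ≟ r
  ... | yes refl | yes refl = k≢m refl
  ... | no k≢r | _ = differ-k (agree k k≤ k≢r)
  ... | _ | no m≢r = differ-m (agree m m≤ m≢r)

  agree-everywhere⇒≡ : ∀ u w k → (∀ j → j ≤ len (φ u) → j ≢ k → at (φ u) j ≡ at (φ w) j) →
                       (k ≤ len (φ u) → at (φ u) k ≡ at (φ w) k) → u ≡ w
  agree-everywhere⇒≡ u w k agree-off agree-at = φ-injective (GeoCarrier-ext (φ u) (φ w) (len-φ u w) agree)
    where
    agree : ∀ j → j ≤ len (φ u) → at (φ u) j ≡ at (φ w) j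
    agree j j≤ with j ≟ k
    ... | yes refl = agree-at j≤
    ... | no j≢k = agree-off j j≤ j≢k

  agree-off⇒adj : ∀ u w k → u ≢ w → (∀ j → j ≤ len (φ u) → j ≢ k → at (φ u) j ≡ at (φ w) j) → adj H u w ≡ true
  agree-off⇒adj u w k u≢w agree with k ≤? len (φ u)
  ... | no k≰ = ⊥-elim (u≢w (agree-everywhere⇒≡ u w k agree (λ k≤ → ⊥-elim (k≰ k≤))))
  ... | yes k≤ with at (φ u) k Fin.≟ at (φ w) k
  ...   | no differ = OneDiff⇒adj u w (k , k≤ , differ , agree)
  ...   | yes same = ⊥-elim (u≢w (agree-everywhere⇒≡ u w k agree (λ _ → same)))

  swapped-vertex : ∀ x z s → (∀ j → j ≤ len (φ z) → suc j ≡ s ⊎ j ≡ suc s → at (φ x) j ≡ at (φ z) j) →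
                   ∃ λ r → (s ≤ len (φ z) → at (φ r) s ≡ at (φ x) s) ×
                           (∀ j → j ≤ len (φ z) → j ≢ s → at (φ r) j ≡ at (φ z) j)
  swapped-vertex x z s near with φ-onto _ _ (swapIn-geo (φ x) (φ z) s (φ-geo x) (φ-geo z) near)
  ... | r , φr≡ = r , (λ s≤ → trans (follows s s≤) (swapIn-at-s (φ x) (φ z) s)) ,
                  λ j j≤ j≢s → trans (follows j j≤) (swapIn-off-s (φ x) (φ z) s j j≢s)
    where
    follows : ∀ i → i ≤ len (φ z) → at (φ r) i ≡ swapIn (φ x) (φ z) s i
    follows i i≤ = trans (cong (λ p → at p i) φr≡) (toFun-fromFun (swapIn (φ x) (φ z) s) (len (φ z)) i i≤)

  -- If c differs from x only at s and from z only at t, where s + 1 < t and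
  -- x ≁ z, then putting the vertex of x at s into z gives a geodesic r, and
  -- c x r z is an induced C4.
  exchange-C4 : ∀ c x z s t → adj H x z ≡ false → suc s < t →
                DiffersOnlyAt (φ c) (φ x) s → DiffersOnlyAt (φ c) (φ z) t → HasInduced H 4 (cycAdj 4)
  exchange-C4 c x z s t x≁z s+1<t (s≤ , C≢X , C=X) (t≤ , C≢Z , C=Z) =
    induced-C4 H (OneDiff⇒adj c x (s , s≤ , C≢X , C=X)) x~r r~z (adj-sym′ (OneDiff⇒adj c z (t , t≤ , C≢Z , C=Z)))
               c≁r x≁z c≢r x≢z
    where
    C = φ c
    X = φ x
    Z = φ z
    s≢t : s ≢ t
    s≢t = <⇒≢ (<-trans (n<1+n s) s+1<t)
    X≤C : ∀ {j} → j ≤ len X → j ≤ len C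
    X≤C = subst (_ ≤_) (len-φ x c)
    Z≤C : ∀ {j} → j ≤ len Z → j ≤ len C
    Z≤C = subst (_ ≤_) (len-φ z c)
    C≤Z : ∀ {j} → j ≤ len C → j ≤ len Z
    C≤Z = subst (_ ≤_) (len-φ c z)
    X=Z : ∀ j → j ≤ len C → j ≢ s → j ≢ t → at X j ≡ at Z j
    X=Z j j≤ j≢s j≢t = trans (sym (C=X j j≤ j≢s)) (C=Z j j≤ j≢t)
    near : ∀ j → j ≤ len Z → suc j ≡ s ⊎ j ≡ suc s → at X j ≡ at Z j
    near j j≤ (inj₁ refl) = X=Z j (Z≤C j≤) (<⇒≢ (n<1+n j)) (<⇒≢ (<-trans (n<1+n j) (<-trans (n<1+n _) s+1<t)))
    near j j≤ (inj₂ refl) = X=Z j (Z≤C j≤) (λ eq → 1+n≢n eq) (<⇒≢ s+1<t)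
    r = proj₁ (swapped-vertex x z s near)
    R = φ r
    R-at-s : at R s ≡ at X s
    R-at-s = proj₁ (proj₂ (swapped-vertex x z s near)) (C≤Z s≤)
    R-off-s : ∀ j → j ≤ len C → j ≢ s → at R j ≡ at Z j
    R-off-s j j≤ = proj₂ (proj₂ (swapped-vertex x z s near)) j (C≤Z j≤)
    x~r : adj H x r ≡ true
    x~r = OneDiff⇒adj x r (t , C≤X t≤ , X≢R , X=R)
      where
      C≤X : ∀ {j} → j ≤ len C → j ≤ len X
      C≤X = subst (_ ≤_) (len-φ c x)
      X≢R : at X t ≢ at R t
      X≢R eq = C≢Z (trans (C=X t t≤ (λ t≡s → s≢t (sym t≡s))) (trans eq (R-off-s t t≤ (λ t≡s → s≢t (sym t≡s)))))
      X=R : ∀ j → j ≤ len X → j ≢ t → at X j ≡ at R j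
      X=R j j≤ j≢t with j ≟ s
      ... | yes refl = sym R-at-s
      ... | no j≢s = trans (X=Z j (X≤C j≤) j≢s j≢t) (sym (R-off-s j (X≤C j≤) j≢s))
    r~z : adj H r z ≡ true
    r~z = adj-sym′ (OneDiff⇒adj z r (s , C≤Z s≤ , Z≢R , Z=R))
      where
      Z≢R : at Z s ≢ at R s
      Z≢R eq = C≢X (trans (C=Z s s≤ s≢t) (trans eq R-at-s))
      Z=R : ∀ j → j ≤ len Z → j ≢ s → at Z j ≡ at R j
      Z=R j j≤ j≢s = sym (R-off-s j (Z≤C j≤) j≢s)
    c≁r : adj H c r ≡ false
    c≁r = ¬true⇒false λ c~r → two-differences⇒¬OneDiff C R s t s≢t s≤ t≤
            (λ eq → C≢X (trans eq R-at-s))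
            (λ eq → C≢Z (trans eq (R-off-s t t≤ (λ t≡s → s≢t (sym t≡s)))))
            (adj⇒OneDiff c r c~r)
    c≢r : c ≢ r
    c≢r c≡r = C≢X (trans (cong (λ v → at (φ v) s) c≡r) R-at-s)
    x≢z : x ≢ z
    x≢z refl = C≢X (C=Z s s≤ s≢t)

  -- H is claw-free: the three leaves of a claw at c differ from c at pairwise
  -- distinct positions (equal positions would make two leaves adjacent), and two
  -- of these positions are at distance at least two, giving an induced C4.
  claw-free : CkFreeFrom4 H → ClawFree H
  claw-free no-hole (f , f-injective , table) = spread⇒C4 (three-spread position position-distinct)
    where
    leaf-diff : ∀ u → OneDiff (φ (f zero)) (φ (f (suc u)))
    leaf-diff u = adj⇒OneDiff (f zero) (f (suc u)) (table zero (suc u))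
    position : Fin 3 → ℕ
    position u = proj₁ (leaf-diff u)
    position-distinct : ∀ u w → u ≢ w → position u ≢ position w
    position-distinct u w u≢w same with leaf-diff u | leaf-diff w
    ... | (k , k≤ , _ , agree-u) | (m , _ , _ , agree-w) =
      true≢false (trans (sym (agree-off⇒adj (f (suc u)) (f (suc w)) k leaves-distinct agree)) (table (suc u) (suc w)))
      where
      leaves-distinct : f (suc u) ≢ f (suc w)
      leaves-distinct eq = u≢w (FinP.suc-injective (f-injective eq))
      agree : ∀ j → j ≤ len (φ (f (suc u))) → j ≢ k → at (φ (f (suc u))) j ≡ at (φ (f (suc w))) j
      agree j j≤ j≢k = trans (sym (agree-u j j≤′ j≢k)) (agree-w j j≤′ (λ j≡m → j≢k (trans j≡m (sym same))))
        where j≤′ = subst (j ≤_) (len-φ (f (suc u)) (f zero)) j≤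
    spread⇒C4 : (∃ λ u → ∃ λ w → suc (position u) < position w) → ⊥
    spread⇒C4 (u , w , far) = no-hole 4 ≤-refl (exchange-C4 (f zero) (f (suc u)) (f (suc w)) (position u) (position w)
                                 (table (suc u) (suc w)) far (proj₂ (leaf-diff u)) (proj₂ (leaf-diff w)))

  -- In a clique containing x and y whose geodesics differ only at k, every
  -- member agrees with x off k: a member differing from x at some m ≢ k would
  -- differ from y both at k and at m.
  clique-agrees-off : ∀ C → IsClique H C → ∀ x y k → x ∈ C → y ∈ C → DiffersOnlyAt (φ x) (φ y) k →
                      ∀ v → v ∈ C → ∀ j → j ≤ len (φ x) → j ≢ k → at (φ x) j ≡ at (φ v) j
  clique-agrees-off C clique x y k x∈C y∈C (k≤ , x≢y-at-k , x=y) v v∈C j j≤ j≢k with v Fin.≟ x | v Fin.≟ y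
  ... | yes refl | _ = refl
  ... | no _ | yes refl = x=y j j≤ j≢k
  ... | no v≢x | no v≢y with adj⇒OneDiff x v (clique x v x∈C v∈C (λ eq → v≢x (sym eq)))
  ...   | m , m≤ , x≢v-at-m , x=v with k ≟ m
  ...     | yes refl = x=v j j≤ j≢k
  ...     | no k≢m = ⊥-elim (two-differences⇒¬OneDiff (φ y) (φ v) k m k≢m
                (subst (k ≤_) (len-φ x y) k≤) (subst (m ≤_) (len-φ x y) m≤)
                (λ eq → x≢y-at-k (trans (x=v k k≤ k≢m) (sym eq)))
                (λ eq → x≢v-at-m (trans (x=y m m≤ (λ m≡k → k≢m (sym m≡k))) eq))
                (adj⇒OneDiff y v (clique y v y∈C v∈C (λ eq → v≢y (sym eq)))))

  -- A clique A sharing two vertices with a maximal clique B lies inside B: each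
  -- w ∈ A agrees with every u ∈ B off the common position, so w is adjacent to
  -- all of B.
  clique-absorbed : ∀ A B → IsClique H A → IsMaximalClique H B → ∀ x y → x ≢ y →
                    x ∈ A → y ∈ A → x ∈ B → y ∈ B → A ⊆ B
  clique-absorbed A B clique-A (clique-B , maximal-B) x y x≢y x∈A y∈A x∈B y∈B {w} w∈A with w ∈? B
  ... | yes w∈B = w∈B
  ... | no w∉B = ⊥-elim (maximal-B w w∉B λ u u∈B →
          agree-off⇒adj w u k (λ w≡u → w∉B (subst (_∈ B) (sym w≡u) u∈B)) λ j j≤ j≢k →
            let j≤x = subst (j ≤_) (len-φ w x) j≤ in
            trans (sym (clique-agrees-off A clique-A x y k x∈A y∈A diff w w∈A j j≤x j≢k))
                  (clique-agrees-off B clique-B x y k x∈B y∈B diff u u∈B j j≤x j≢k))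
    where
    k = proj₁ (adj⇒OneDiff x y (clique-A x y x∈A y∈A x≢y))
    diff = proj₂ (adj⇒OneDiff x y (clique-A x y x∈A y∈A x≢y))

  maximal-cliques-meet : ∀ S T → IsMaximalClique H S → IsMaximalClique H T → S ≢ T → ∣ S ∩ T ∣ ≤ 1
  maximal-cliques-meet S T max-S max-T S≢T with ∣ S ∩ T ∣ ≤? 1
  ... | yes ≤1 = ≤1
  ... | no ≰1 with 2≤∣p∣⇒two-elements (S ∩ T) (≰⇒> ≰1)
  ...   | x , y , x∈S∩T , y∈S∩T , x≢y with x∈p∩q⁻ S T x∈S∩T | x∈p∩q⁻ S T y∈S∩T
  ...     | x∈S , x∈T | y∈S , y∈T = ⊥-elim (S≢T (⊆-antisym
              (clique-absorbed S T (proj₁ max-S) max-T x y x≢y x∈S y∈S x∈T y∈T)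
              (clique-absorbed T S (proj₁ max-T) max-S x y x≢y x∈T y∈T x∈S y∈S)))

  tree-of-cliques : CkFreeFrom4 H → TreeOfCliques H
  tree-of-cliques no-hole = no-hole , claw-free no-hole , maximal-cliques-meet

module ShortestWalks (K : Graph) (A B : Fin (V K) → Bool) where
  open GraphFacts K

  WalkAB : ℕ → (ℕ → Vx) → Set
  WalkAB m f = A (f 0) ≡ true × B (f m) ≡ true × Steps m f

  InducedAB : ℕ → (ℕ → Vx) → Set
  InducedAB m f = WalkAB m f
    × (∀ i j → i < j → j ≤ m → f i ≢ f j)
    × (∀ i j → suc i < j → j ≤ m → adj K (f i) (f j) ≡ false)
    × (∀ i → 0 < i → i ≤ m → A (f i) ≡ false)
    × (∀ i → i < m → B (f i) ≡ false)

  Shorter : ℕ → Set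
  Shorter m = ∃ λ m′ → m′ < m × ∃ λ g → WalkAB m′ g

  B-early⇒shorter : ∀ m f → WalkAB m f → ∀ i → i < m → B (f i) ≡ true → Shorter m
  B-early⇒shorter m f (start , _ , steps) i i<m Bi = i , i<m , f , start , Bi , Steps-≤ f (<⇒≤ i<m) steps

  A-late⇒shorter : ∀ m f → WalkAB m f → ∀ i → 0 < i → i ≤ m → A (f i) ≡ true → Shorter m
  A-late⇒shorter m f (_ , end , steps) i 0<i i≤m Ai =
    m ∸ i , ∸-monoʳ-< 0<i i≤m , (λ k → f (k + i)) , Ai ,
    subst (λ k → B (f k) ≡ true) (sym (m∸n+n≡m i≤m)) end ,
    λ k k< → steps (k + i) (subst (k + i <_) (m∸n+n≡m i≤m) (+-monoˡ-< i k<))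

  chord⇒shorter : ∀ i d e f → WalkAB (suc i + suc d + e) f → adj K (f i) (f (suc i + suc d)) ≡ true →
                  Shorter (suc i + suc d + e)
  chord⇒shorter i d e f (start , end , steps) chord =
    suc i + e , shorter , splice f f i (suc d) , subst (λ v → A v ≡ true) (sym (splice-≤ f f i (suc d) 0 z≤n)) start ,
    subst (λ v → B v ≡ true) (sym g-end) end ,
    splice-Steps f f i (suc d) (suc i + e) (Steps-≤ f i≤m steps) chord (subst (λ L → Steps L f) (sym m≡) steps)
    where
    m≡ : suc i + e + suc d ≡ suc i + suc d + e
    m≡ = +-swapʳ (suc i) e (suc d)
    shorter : suc i + e < suc i + suc d + e
    shorter = subst (suc i + e <_) m≡ (m<m+n (suc i + e) (s≤s z≤n))
    i≤m : i ≤ suc i + suc d + e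
    i≤m = ≤-trans (n≤1+n i) (≤-trans (m≤m+n (suc i) (suc d)) (m≤m+n _ e))
    g-end : splice f f i (suc d) (suc i + e) ≡ f (suc i + suc d + e)
    g-end = trans (splice-> f f i (suc d) (suc i + e) (s≤s (m≤m+n i e))) (cong f m≡)

  repeat⇒shorter : ∀ m f → WalkAB m f → ∀ i j → i < j → j ≤ m → f i ≡ f j → Shorter m
  repeat⇒shorter m f walk@(start , end , steps) i j i<j j≤m fi≡fj with m≤n⇒m<n∨m≡n j≤m
  ... | inj₂ refl = i , i<j , f , start , subst (λ v → B v ≡ true) (sym fi≡fj) end , Steps-≤ f (<⇒≤ i<j) steps
  ... | inj₁ j<m with <⇒+suc i<j | <⇒+suc j<m
  ...   | d , refl | e , refl =
    subst Shorter (sym (+-suc (i + suc d) e)) (chord⇒shorter i d e f (subst (λ L → WalkAB L f) (+-suc (i + suc d) e) walk)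
                  (adj-resp (sym fi≡fj) refl (steps (i + suc d) (m<m+n _ (s≤s z≤n)))))

  chordal⇒shorter : ∀ m f → WalkAB m f → ∀ i j → suc i < j → j ≤ m → adj K (f i) (f j) ≡ true → Shorter m
  chordal⇒shorter m f walk i j i+1<j j≤m chord with <⇒+suc i+1<j | ≤⇒+ j≤m
  ... | d , refl | e , refl = chord⇒shorter i d e f walk chord

  improve : ∀ m f → WalkAB m f → Shorter m ⊎ InducedAB m f
  improve m f walk with anyUpTo? (λ i → B (f i) BoolP.≟ true) m
  ... | yes (i , i<m , Bi) = inj₁ (B-early⇒shorter m f walk i i<m Bi)
  ... | no no-B with anyUpTo? (λ i → (0 <? i) ×-dec (A (f i) BoolP.≟ true)) (suc m)
  ...   | yes (i , i≤m , 0<i , Ai) = inj₁ (A-late⇒shorter m f walk i 0<i (s≤s⁻¹ i≤m) Ai)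
  ...   | no no-A with anyUpTo? (λ i → anyUpTo? (λ j → (i <? j) ×-dec (f i Fin.≟ f j)) (suc m)) (suc m)
  ...     | yes (i , _ , j , j≤m , i<j , eq) = inj₁ (repeat⇒shorter m f walk i j i<j (s≤s⁻¹ j≤m) eq)
  ...     | no no-repeat with anyUpTo? (λ i → anyUpTo? (λ j → (suc i <? j) ×-dec (adj K (f i) (f j) BoolP.≟ true)) (suc m)) (suc m)
  ...       | yes (i , _ , j , j≤m , i+1<j , chord) = inj₁ (chordal⇒shorter m f walk i j i+1<j (s≤s⁻¹ j≤m) chord)
  ...       | no no-chord = inj₂ (walk , distinct , chordless , A-only-start , B-only-end)
    where
    distinct : ∀ i j → i < j → j ≤ m → f i ≢ f j
    distinct i j i<j j≤m eq = no-repeat (i , <-≤-trans i<j (m≤n⇒m≤1+n j≤m) , j , s≤s j≤m , i<j , eq)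
    chordless : ∀ i j → suc i < j → j ≤ m → adj K (f i) (f j) ≡ false
    chordless i j i+1<j j≤m = ¬true⇒false λ chord →
      no-chord (i , <-trans (n<1+n i) (<-≤-trans i+1<j (m≤n⇒m≤1+n j≤m)) , j , s≤s j≤m , i+1<j , chord)
    A-only-start : ∀ i → 0 < i → i ≤ m → A (f i) ≡ false
    A-only-start i 0<i i≤m = ¬true⇒false λ Ai → no-A (i , s≤s i≤m , 0<i , Ai)
    B-only-end : ∀ i → i < m → B (f i) ≡ false
    B-only-end i i<m = ¬true⇒false λ Bi → no-B (i , i<m , Bi)

  induced-path : ∀ m f → WalkAB m f → ∃ λ m′ → ∃ λ g → InducedAB m′ g
  induced-path = <-rec (λ m → ∀ f → WalkAB m f → ∃ λ m′ → ∃ λ g → InducedAB m′ g) step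
    where
    step : ∀ m → (∀ {m′} → m′ < m → ∀ f → WalkAB m′ f → ∃ λ m″ → ∃ λ g → InducedAB m″ g) →
           ∀ f → WalkAB m f → ∃ λ m′ → ∃ λ g → InducedAB m′ g
    step m shorter-done f walk with improve m f walk
    ... | inj₁ (m′ , m′<m , g , walk′) = shorter-done m′<m g walk′
    ... | inj₂ induced = m , f , induced

anyᵇ : ∀ {n} → (Fin n → Bool) → Bool
anyᵇ {zero} P = false
anyᵇ {suc n} P = P zero ∨ anyᵇ (λ i → P (suc i))

anyᵇ⇒witness : ∀ {n} (P : Fin n → Bool) → anyᵇ P ≡ true → ∃ λ u → P u ≡ true
anyᵇ⇒witness {suc n} P holds with P zero in P0
... | true = zero , P0
... | false with anyᵇ⇒witness (λ i → P (suc i)) holds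
...   | u , Pu = suc u , Pu

witness⇒anyᵇ : ∀ {n} (P : Fin n → Bool) u → P u ≡ true → anyᵇ P ≡ true
witness⇒anyᵇ {suc n} P zero Pu rewrite Pu = refl
witness⇒anyᵇ {suc n} P (suc u) Pu rewrite witness⇒anyᵇ (λ i → P (suc i)) u Pu = BoolP.∨-zeroʳ (P zero)

anyᵇ-cong : ∀ {n} (P Q : Fin n → Bool) → (∀ u → P u ≡ Q u) → anyᵇ P ≡ anyᵇ Q
anyᵇ-cong {zero} P Q _ = refl
anyᵇ-cong {suc n} P Q P=Q = cong₂ _∨_ (P=Q zero) (anyᵇ-cong _ _ (λ u → P=Q (suc u)))

count : ∀ {n} → (Fin n → Bool) → ℕ
count {zero} S = 0
count {suc n} S = (if S zero then 1 else 0) + count (λ i → S (suc i))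

_⊑_ : ∀ {n} → (Fin n → Bool) → (Fin n → Bool) → Set
S ⊑ T = ∀ i → S i ≡ true → T i ≡ true

count≤n : ∀ {n} (S : Fin n → Bool) → count S ≤ n
count≤n {zero} S = z≤n
count≤n {suc n} S with S zero
... | true = s≤s (count≤n (λ i → S (suc i)))
... | false = m≤n⇒m≤1+n (count≤n (λ i → S (suc i)))

count-mono : ∀ {n} (S T : Fin n → Bool) → S ⊑ T → count S ≤ count T
count-mono {zero} S T _ = z≤n
count-mono {suc n} S T S⊑T with S zero in S0 | T zero in T0
... | true | true = s≤s (count-mono _ _ (λ i → S⊑T (suc i)))
... | true | false = ⊥-elim (true≢false (trans (sym (S⊑T zero S0)) T0))
... | false | true = m≤n⇒m≤1+n (count-mono _ _ (λ i → S⊑T (suc i)))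
... | false | false = count-mono _ _ (λ i → S⊑T (suc i))

count-strict : ∀ {n} (S T : Fin n → Bool) → S ⊑ T → ∀ w → S w ≡ false → T w ≡ true → count S < count T
count-strict {suc n} S T S⊑T zero Sw Tw rewrite Sw | Tw = s≤s (count-mono _ _ (λ i → S⊑T (suc i)))
count-strict {suc n} S T S⊑T (suc w) Sw Tw with S zero in S0 | T zero in T0
... | true | true = s≤s (count-strict _ _ (λ i → S⊑T (suc i)) w Sw Tw)
... | true | false = ⊥-elim (true≢false (trans (sym (S⊑T zero S0)) T0))
... | false | true = m≤n⇒m≤1+n (count-strict _ _ (λ i → S⊑T (suc i)) w Sw Tw)
... | false | false = count-strict _ _ (λ i → S⊑T (suc i)) w Sw Tw

-- It is the ball of radius n = |V K| around y, which is
-- closed because the balls grow strictly until they stabilise.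
module Component (K : Graph) (y : Fin (V K)) where
  open GraphFacts K

  ball : ℕ → Vx → Bool
  ball zero w with w Fin.≟ y
  ... | yes _ = true
  ... | no _ = false
  ball (suc k) w = ball k w ∨ anyᵇ (λ u → ball k u ∧ adj K u w)

  y∈ball : ∀ k → ball k y ≡ true
  y∈ball zero with y Fin.≟ y
  ... | yes _ = refl
  ... | no y≢y = ⊥-elim (y≢y refl)
  y∈ball (suc k) rewrite y∈ball k = refl

  ball-mono : ∀ k → ball k ⊑ ball (suc k)
  ball-mono k w w∈ rewrite w∈ = refl

  Stable : ℕ → Set
  Stable k = ∀ w → ball (suc k) w ≡ ball k w

  stable-suc : ∀ k → Stable k → Stable (suc k)
  stable-suc k stable w = cong₂ _∨_ (stable w) (anyᵇ-cong _ _ (λ u → cong (_∧ adj K u w) (stable u)))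

  stable-≤ : ∀ j k → j ≤ k → Stable j → Stable k
  stable-≤ j k j≤k stable with ≤⇒+ j≤k
  ... | e , refl = go e
    where
    go : ∀ e → Stable (j + e)
    go zero = subst Stable (sym (+-identityʳ j)) stable
    go (suc e) = subst Stable (sym (+-suc j e)) (stable-suc (j + e) (go e))

  stable-or-large : ∀ k → (∃ λ j → j ≤ k × Stable j) ⊎ k < count (ball k)
  stable-or-large zero = inj₂ (subst (_< count (ball 0)) (count-empty (V K))
                           (count-strict (λ _ → false) (ball 0) (λ _ ()) y refl (y∈ball 0)))
    where
    count-empty : ∀ n → count {n} (λ _ → false) ≡ 0
    count-empty zero = refl
    count-empty (suc n) = count-empty n
  stable-or-large (suc k) with stable-or-large k
  ... | inj₁ (j , j≤k , stable) = inj₁ (j , m≤n⇒m≤1+n j≤k , stable)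
  ... | inj₂ large with FinP.any? (λ w → (ball (suc k) w BoolP.≟ true) ×-dec (ball k w BoolP.≟ false))
  ...   | yes (w , new , old) = inj₂ (≤-<-trans large (count-strict (ball k) (ball (suc k)) (ball-mono k) w old new))
  ...   | no no-new = inj₁ (k , n≤1+n k , stable)
    where
    stable : Stable k
    stable w = grown⇒equal (ball-mono k w) (λ new old → no-new (w , new , old))
      where
      grown⇒equal : ∀ {p q : Bool} → (p ≡ true → q ≡ true) → (q ≡ true → p ≡ false → ⊥) → q ≡ p
      grown⇒equal {true} p⇒q _ = p⇒q refl
      grown⇒equal {false} {false} _ _ = refl
      grown⇒equal {false} {true} _ not-new = ⊥-elim (not-new refl refl)

  component : Vx → Bool
  component = ball (V K)

  component-stable : Stable (V K)
  component-stable with stable-or-large (V K)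
  ... | inj₁ (j , j≤n , stable) = stable-≤ j (V K) j≤n stable
  ... | inj₂ large = ⊥-elim (<⇒≱ large (count≤n (ball (V K))))

  y∈component : component y ≡ true
  y∈component = y∈ball (V K)

  component-closed : ∀ u w → component u ≡ true → adj K u w ≡ true → component w ≡ true
  component-closed u w u∈ uw =
    trans (sym (component-stable w))
          (trans (cong (component w ∨_) (witness⇒anyᵇ _ u (subst₂ (λ p q → p ∧ q ≡ true) (sym u∈) (sym uw) refl)))
                 (BoolP.∨-zeroʳ (component w)))

  ball⇒walk : ∀ k w → ball k w ≡ true → ∃ λ m → ∃ λ f → f 0 ≡ y × f m ≡ w × Steps m f
  ball⇒walk zero w w∈ with w Fin.≟ y
  ... | yes refl = 0 , (λ _ → y) , refl , refl , λ i ()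
  ball⇒walk (suc k) w w∈ with ball k w in old
  ... | true = ball⇒walk k w old
  ... | false with anyᵇ⇒witness _ w∈
  ...   | u , u∈∧uw with ball k u in u∈ | adj K u w in uw
  ...     | true | true with ball⇒walk k u u∈
  ...       | m , f , start , end , steps =
    suc m , splice f (λ _ → w) m 0 , trans (splice-≤ f (λ _ → w) m 0 0 z≤n) start ,
    splice-> f (λ _ → w) m 0 (suc m) ≤-refl , extend-Steps f m w steps (trans (cong (λ v → adj K v w) end) uw)

  component⇒walk : ∀ w → component w ≡ true → ∃ λ m → ∃ λ f → f 0 ≡ y × f m ≡ w × Steps m f
  component⇒walk = ball⇒walk (V K)

-- Equivalently, the graph is an induced subgraph of a rook's graph.
record IsRook {n} (A : Fin n → Fin n → Bool) (ℓ r : Fin n → ℕ) : Set where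
  field
    adj⇒share : ∀ u v → A u v ≡ true → ℓ u ≡ ℓ v ⊎ r u ≡ r v
    share⇒adj : ∀ u v → u ≢ v → ℓ u ≡ ℓ v ⊎ r u ≡ r v → A u v ≡ true
    injective : ∀ u v → ℓ u ≡ ℓ v → r u ≡ r v → u ≡ v

IsRook-swap : ∀ {n} {A : Fin n → Fin n → Bool} {ℓ r} → IsRook A ℓ r → IsRook A r ℓ
IsRook-swap rook = record
  { adj⇒share = λ u v uv → swap⊎ (adj⇒share u v uv)
  ; share⇒adj = λ u v u≢v shared → share⇒adj u v u≢v (swap⊎ shared)
  ; injective = λ u v r= ℓ= → injective u v ℓ= r=
  }
  where open IsRook rook

-- A strict upper bound for all labels: a fresh label, and a shift that moves
-- labels out of the range in use.
maxF : ∀ {n} → (Fin n → ℕ) → ℕ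
maxF {zero} f = 0
maxF {suc n} f = f zero ⊔ maxF (λ i → f (suc i))

maxF-ub : ∀ {n} (f : Fin n → ℕ) i → f i ≤ maxF f
maxF-ub {suc n} f zero = m≤m⊔n (f zero) _
maxF-ub {suc n} f (suc i) = ≤-trans (maxF-ub (λ j → f (suc j)) i) (m≤n⊔m (f zero) _)

bound : ∀ {n} → (Fin n → ℕ) → (Fin n → ℕ) → ℕ
bound ℓ r = suc (maxF (λ i → ℓ i + r i))

ℓ<bound : ∀ {n} (ℓ r : Fin n → ℕ) i → ℓ i < bound ℓ r
ℓ<bound ℓ r i = s≤s (≤-trans (m≤m+n (ℓ i) (r i)) (maxF-ub (λ j → ℓ j + r j) i))

r<bound : ∀ {n} (ℓ r : Fin n → ℕ) i → r i < bound ℓ r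
r<bound ℓ r i = s≤s (≤-trans (m≤n+m (r i) (ℓ i)) (maxF-ub (λ j → ℓ j + r j) i))

<⇒≢+ : ∀ x y M → x < M → x ≢ y + M
<⇒≢+ x y M x<M = <⇒≢ (<-≤-trans x<M (m≤n+m M y))

-- Exchanging the coordinates on a set R closed under adjacency (shifting them
-- by the bound M, so that no label of R meets a label outside R) gives again a
-- rook labelling.
module Flip {n} (A : Fin n → Fin n → Bool) (A-sym : ∀ u v → A u v ≡ A v u)
            (ℓ r : Fin n → ℕ) (rook : IsRook A ℓ r)
            (R : Fin n → Bool) (R-closed : ∀ u v → R u ≡ true → A u v ≡ true → R v ≡ true) where
  open IsRook rook

  M : ℕ
  M = bound ℓ r

  ℓ′ : Fin n → ℕ
  ℓ′ w with R w
  ... | true = r w + M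
  ... | false = ℓ w

  r′ : Fin n → ℕ
  r′ w with R w
  ... | true = ℓ w + M
  ... | false = r w

  ℓ′-in : ∀ w → R w ≡ true → ℓ′ w ≡ r w + M
  ℓ′-in w w∈ with R w
  ℓ′-in w refl | true = refl

  ℓ′-out : ∀ w → R w ≡ false → ℓ′ w ≡ ℓ w
  ℓ′-out w w∉ with R w
  ℓ′-out w refl | false = refl

  r′-in : ∀ w → R w ≡ true → r′ w ≡ ℓ w + M
  r′-in w w∈ with R w
  r′-in w refl | true = refl

  r′-out : ∀ w → R w ≡ false → r′ w ≡ r w
  r′-out w w∉ with R w
  r′-out w refl | false = refl

  data Sides (u v : Fin n) : Set where
    both-in : R u ≡ true → R v ≡ true → Sides u v
    both-out : R u ≡ false → R v ≡ false → Sides u v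
    in-out : R u ≡ true → R v ≡ false → Sides u v
    out-in : R u ≡ false → R v ≡ true → Sides u v

  sides : ∀ u v → Sides u v
  sides u v with R u in Ru | R v in Rv
  ... | true | true = both-in Ru Rv
  ... | false | false = both-out Ru Rv
  ... | true | false = in-out Ru Rv
  ... | false | true = out-in Ru Rv

  separated : ∀ u v → R u ≡ true → R v ≡ false → ¬ (ℓ′ u ≡ ℓ′ v ⊎ r′ u ≡ r′ v)
  separated u v u∈ v∉ (inj₁ eq) = <⇒≢+ (ℓ v) (r u) M (ℓ<bound ℓ r v) (sym (trans (sym (ℓ′-in u u∈)) (trans eq (ℓ′-out v v∉))))
  separated u v u∈ v∉ (inj₂ eq) = <⇒≢+ (r v) (ℓ u) M (r<bound ℓ r v) (sym (trans (sym (r′-in u u∈)) (trans eq (r′-out v v∉))))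

  in-ℓ′ : ∀ u v → R u ≡ true → R v ≡ true → ℓ′ u ≡ ℓ′ v ⇔ r u ≡ r v
  in-ℓ′ u v u∈ v∈ = mk⇔ (λ eq → +-cancelʳ-≡ M _ _ (trans (sym (ℓ′-in u u∈)) (trans eq (ℓ′-in v v∈))))
                        (λ eq → trans (ℓ′-in u u∈) (trans (cong (_+ M) eq) (sym (ℓ′-in v v∈))))

  in-r′ : ∀ u v → R u ≡ true → R v ≡ true → r′ u ≡ r′ v ⇔ ℓ u ≡ ℓ v
  in-r′ u v u∈ v∈ = mk⇔ (λ eq → +-cancelʳ-≡ M _ _ (trans (sym (r′-in u u∈)) (trans eq (r′-in v v∈))))
                        (λ eq → trans (r′-in u u∈) (trans (cong (_+ M) eq) (sym (r′-in v v∈))))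

  out-ℓ′ : ∀ u v → R u ≡ false → R v ≡ false → ℓ′ u ≡ ℓ′ v ⇔ ℓ u ≡ ℓ v
  out-ℓ′ u v u∉ v∉ = mk⇔ (λ eq → trans (sym (ℓ′-out u u∉)) (trans eq (ℓ′-out v v∉)))
                         (λ eq → trans (ℓ′-out u u∉) (trans eq (sym (ℓ′-out v v∉))))

  out-r′ : ∀ u v → R u ≡ false → R v ≡ false → r′ u ≡ r′ v ⇔ r u ≡ r v
  out-r′ u v u∉ v∉ = mk⇔ (λ eq → trans (sym (r′-out u u∉)) (trans eq (r′-out v v∉)))
                         (λ eq → trans (r′-out u u∉) (trans eq (sym (r′-out v v∉))))

  new-share⇒old : ∀ u v → ℓ′ u ≡ ℓ′ v ⊎ r′ u ≡ r′ v → ℓ u ≡ ℓ v ⊎ r u ≡ r v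
  new-share⇒old u v shared with sides u v
  ... | both-in u∈ v∈ = swap⊎ (map⊎ (Equivalence.to (in-ℓ′ u v u∈ v∈)) (Equivalence.to (in-r′ u v u∈ v∈)) shared)
  ... | both-out u∉ v∉ = map⊎ (Equivalence.to (out-ℓ′ u v u∉ v∉)) (Equivalence.to (out-r′ u v u∉ v∉)) shared
  ... | in-out u∈ v∉ = ⊥-elim (separated u v u∈ v∉ shared)
  ... | out-in u∉ v∈ = ⊥-elim (separated v u v∈ u∉ (map⊎ sym sym shared))

  flipped : IsRook A ℓ′ r′
  flipped = record
    { adj⇒share = adj⇒share′
    ; share⇒adj = λ u v u≢v shared → share⇒adj u v u≢v (new-share⇒old u v shared)
    ; injective = injective′
    }
    where
    adj⇒share′ : ∀ u v → A u v ≡ true → ℓ′ u ≡ ℓ′ v ⊎ r′ u ≡ r′ v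
    adj⇒share′ u v uv with sides u v
    ... | both-in u∈ v∈ = map⊎ (Equivalence.from (in-ℓ′ u v u∈ v∈)) (Equivalence.from (in-r′ u v u∈ v∈)) (swap⊎ (adj⇒share u v uv))
    ... | both-out u∉ v∉ = map⊎ (Equivalence.from (out-ℓ′ u v u∉ v∉)) (Equivalence.from (out-r′ u v u∉ v∉)) (adj⇒share u v uv)
    ... | in-out u∈ v∉ = ⊥-elim (true≢false (trans (sym (R-closed u v u∈ uv)) v∉))
    ... | out-in u∉ v∈ = ⊥-elim (true≢false (trans (sym (R-closed v u v∈ (trans (A-sym v u) uv))) u∉))
    injective′ : ∀ u v → ℓ′ u ≡ ℓ′ v → r′ u ≡ r′ v → u ≡ v
    injective′ u v ℓ= r= with sides u v
    ... | both-in u∈ v∈ = injective u v (Equivalence.to (in-r′ u v u∈ v∈) r=) (Equivalence.to (in-ℓ′ u v u∈ v∈) ℓ=)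
    ... | both-out u∉ v∉ = injective u v (Equivalence.to (out-ℓ′ u v u∉ v∉) ℓ=) (Equivalence.to (out-r′ u v u∉ v∉) r=)
    ... | in-out u∈ v∉ = ⊥-elim (separated u v u∈ v∉ (inj₁ ℓ=))
    ... | out-in u∉ v∈ = ⊥-elim (separated v u v∈ u∉ (inj₁ (sym ℓ=)))

NoClaw : Graph → Set
NoClaw H = ∀ c x y z → adj H c x ≡ true → adj H c y ≡ true → adj H c z ≡ true →
           adj H x y ≡ false → adj H y z ≡ false → adj H x z ≡ false → x ≢ y → y ≢ z → x ≢ z → ⊥

DiamondFree : Graph → Set
DiamondFree H = ∀ p q u w → adj H p q ≡ true → adj H p u ≡ true → adj H q u ≡ true →
                adj H p w ≡ true → adj H q w ≡ true → u ≢ w → adj H u w ≡ true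

ClawFree⇒NoClaw : ∀ H → ClawFree H → NoClaw H
ClawFree⇒NoClaw H claw-free c x y z cx cy cz x≁y y≁z x≁z x≢y y≢z x≢z =
  claw-free (induced-claw H cx cy cz x≁y y≁z x≁z x≢y y≢z x≢z)

graphOn : ∀ n (A : Fin n → Fin n → Bool) → (∀ i j → A i j ≡ A j i) → (∀ i → A i i ≡ false) → Graph
graphOn n A A-sym A-irrefl = record { V = n ; adj = A ; adj-sym = A-sym ; adj-irrefl = A-irrefl }

delete-0 : ∀ (H : Graph) {n} → V H ≡ suc n → Graph
delete-0 H refl = graphOn _ (λ u v → adj H (suc u) (suc v)) (λ u v → adj-sym H (suc u) (suc v)) (λ u → adj-irrefl H (suc u))

record Tame (H : Graph) : Set where
  field
    hole-free : CkFreeFrom4 H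
    no-claw : NoClaw H
    diamond-free : DiamondFree H

Tame-delete-0 : ∀ H {n} (eq : V H ≡ suc n) → Tame H → Tame (delete-0 H eq)
Tame-delete-0 H refl tame = record
  { hole-free = λ k 4≤k (f , f-injective , table) →
      hole-free k 4≤k ((λ i → suc (f i)) , (λ eq → f-injective (FinP.suc-injective eq)) , table)
  ; no-claw = λ c x y z cx cy cz x≁y y≁z x≁z x≢y y≢z x≢z →
      no-claw (suc c) (suc x) (suc y) (suc z) cx cy cz x≁y y≁z x≁z (suc-≢ x≢y) (suc-≢ y≢z) (suc-≢ x≢z)
  ; diamond-free = λ p q u w pq pu qu pw qw u≢w → diamond-free (suc p) (suc q) (suc u) (suc w) pq pu qu pw qw (suc-≢ u≢w)
  }
  where
  open Tame tame
  suc-≢ : ∀ {m} {u v : Fin m} → u ≢ v → Fin.suc u ≢ suc v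
  suc-≢ u≢v eq = u≢v (FinP.suc-injective eq)

-- Extending a rook labelling of H − 0 to H, for a tame graph H on Fin (suc n).
-- N is the neighbourhood of the new vertex 0 among the old vertices.
module Extension (n : ℕ) (A : Fin (suc n) → Fin (suc n) → Bool)
                 (A-sym : ∀ i j → A i j ≡ A j i) (A-irrefl : ∀ i → A i i ≡ false)
                 (tame : Tame (graphOn (suc n) A A-sym A-irrefl)) where
  open Tame tame

  H′ : Graph
  H′ = delete-0 (graphOn (suc n) A A-sym A-irrefl) refl

  A′ : Fin n → Fin n → Bool
  A′ = adj H′

  N : Fin n → Bool
  N w = A zero (suc w)

  N-sym : ∀ {w} → N w ≡ true → A (suc w) zero ≡ true
  N-sym {w} w∈N = trans (A-sym (suc w) zero) w∈N

  0≢suc : ∀ {w : Fin n} → Fin.zero ≢ suc w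
  0≢suc ()

  suc-≢ : ∀ {u v : Fin n} → u ≢ v → Fin.suc u ≢ suc v
  suc-≢ u≢v eq = u≢v (FinP.suc-injective eq)

  Covers : (Fin n → ℕ) → Fin n → Set
  Covers L x = (∀ w → L w ≡ L x → N w ≡ true) × (∀ w → N w ≡ true → A′ x w ≡ true → L w ≡ L x)

  module Labelled (ℓ r : Fin n → ℕ) (rook : IsRook A′ ℓ r) where
    open IsRook rook

    -- If another y ∈ N shares the ℓ-label of x ∈ N, the ℓ-class of x covers:
    -- both facts follow from diamond-freeness applied to the edge x y.
    partner⇒covers : ∀ x y → N x ≡ true → N y ≡ true → ℓ y ≡ ℓ x → y ≢ x → Covers ℓ x
    partner⇒covers x y x∈N y∈N ℓy=ℓx y≢x = class⊆N , N∩nbrs⊆class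
      where
      xy : A′ x y ≡ true
      xy = share⇒adj x y (λ eq → y≢x (sym eq)) (inj₁ (sym ℓy=ℓx))
      class⊆N : ∀ w → ℓ w ≡ ℓ x → N w ≡ true
      class⊆N w ℓw=ℓx with w Fin.≟ x | w Fin.≟ y
      ... | yes refl | _ = x∈N
      ... | no _ | yes refl = y∈N
      ... | no w≢x | no w≢y = diamond-free (suc x) (suc y) zero (suc w) xy (N-sym x∈N) (N-sym y∈N)
                                (share⇒adj x w (λ eq → w≢x (sym eq)) (inj₁ (sym ℓw=ℓx)))
                                (share⇒adj y w (λ eq → w≢y (sym eq)) (inj₁ (trans ℓy=ℓx (sym ℓw=ℓx)))) 0≢suc
      N∩nbrs⊆class : ∀ w → N w ≡ true → A′ x w ≡ true → ℓ w ≡ ℓ x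
      N∩nbrs⊆class w w∈N xw with adj⇒share x w xw
      ... | inj₁ ℓx=ℓw = sym ℓx=ℓw
      ... | inj₂ rx=rw with adj⇒share y w (diamond-free zero (suc x) (suc y) (suc w) x∈N y∈N xy w∈N xw (suc-≢ y≢w))
        where
        y≢w : y ≢ w
        y≢w refl = y≢x (injective y x ℓy=ℓx (sym rx=rw))
      ...   | inj₁ ℓy=ℓw = trans (sym ℓy=ℓw) ℓy=ℓx
      ...   | inj₂ ry=rw = ⊥-elim (y≢x (injective y x ℓy=ℓx (trans ry=rw (sym rx=rw))))

    -- If x ∈ N shares its ℓ-label only with vertices outside N, its r-class
    -- covers: a vertex of the r-class outside N would be the third leaf of a claw
    -- at x.
    lonely⇒covers-r : ∀ x y → N x ≡ true → ℓ y ≡ ℓ x → y ≢ x → N y ≡ false →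
                      (∀ w → N w ≡ true → ℓ w ≡ ℓ x → w ≡ x) → Covers r x
    lonely⇒covers-r x y x∈N ℓy=ℓx y≢x y∉N ℓ-lonely = class⊆N , N∩nbrs⊆class
      where
      class⊆N : ∀ w → r w ≡ r x → N w ≡ true
      class⊆N w rw=rx with w Fin.≟ x
      ... | yes refl = x∈N
      ... | no w≢x with N w in w∈N?
      ...   | true = refl
      ...   | false = ⊥-elim (no-claw (suc x) zero (suc y) (suc w) (N-sym x∈N)
              (share⇒adj x y (λ eq → y≢x (sym eq)) (inj₁ (sym ℓy=ℓx)))
              (share⇒adj x w (λ eq → w≢x (sym eq)) (inj₂ (sym rw=rx)))
              y∉N (¬true⇒false y≁w) w∈N? 0≢suc (suc-≢ y≢w) 0≢suc)
        where
        y≢w : y ≢ w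
        y≢w refl = w≢x (injective y x ℓy=ℓx rw=rx)
        y≁w : ¬ A′ y w ≡ true
        y≁w yw with adj⇒share y w yw
        ... | inj₁ ℓy=ℓw = w≢x (injective w x (trans (sym ℓy=ℓw) ℓy=ℓx) rw=rx)
        ... | inj₂ ry=rw = y≢x (injective y x ℓy=ℓx (trans ry=rw rw=rx))
      N∩nbrs⊆class : ∀ w → N w ≡ true → A′ x w ≡ true → r w ≡ r x
      N∩nbrs⊆class w w∈N xw with adj⇒share x w xw
      ... | inj₂ rx=rw = sym rx=rw
      ... | inj₁ ℓx=ℓw = ⊥-elim (GraphFacts.adj⇒≢ H′ xw (sym (ℓ-lonely w w∈N (sym ℓx=ℓw))))

    alone⇒covers-ℓ : ∀ x → N x ≡ true → (∀ w → ℓ w ≡ ℓ x → w ≡ x) →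
                     (∀ w → N w ≡ true → r w ≡ r x → w ≡ x) → Covers ℓ x
    alone⇒covers-ℓ x x∈N ℓ-alone r-lonely = class⊆N , N∩nbrs⊆class
      where
      class⊆N : ∀ w → ℓ w ≡ ℓ x → N w ≡ true
      class⊆N w ℓw=ℓx = subst (λ v → N v ≡ true) (sym (ℓ-alone w ℓw=ℓx)) x∈N
      N∩nbrs⊆class : ∀ w → N w ≡ true → A′ x w ≡ true → ℓ w ≡ ℓ x
      N∩nbrs⊆class w w∈N xw with adj⇒share x w xw
      ... | inj₁ ℓx=ℓw = sym ℓx=ℓw
      ... | inj₂ rx=rw = ⊥-elim (GraphFacts.adj⇒≢ H′ xw (sym (r-lonely w w∈N (sym rx=rw))))

  lonely : ∀ {L : Fin n → ℕ} {x} → ¬ (∃ λ y → N y ≡ true × L y ≡ L x × y ≢ x) → ∀ w → N w ≡ true → L w ≡ L x → w ≡ x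
  lonely {x = x} no-partner w w∈N Lw=Lx with w Fin.≟ x
  ... | yes w≡x = w≡x
  ... | no w≢x = ⊥-elim (no-partner (w , w∈N , Lw=Lx , w≢x))

  covers : ∀ ℓ r → IsRook A′ ℓ r → ∀ x → N x ≡ true → Covers ℓ x ⊎ Covers r x
  covers ℓ r rook x x∈N with FinP.any? (λ y → (N y BoolP.≟ true) ×-dec (ℓ y ≟ ℓ x) ×-dec ¬? (y Fin.≟ x))
  ... | yes (y , y∈N , ℓy=ℓx , y≢x) = inj₁ (Labelled.partner⇒covers ℓ r rook x y x∈N y∈N ℓy=ℓx y≢x)
  ... | no no-ℓ-partner with FinP.any? (λ y → (N y BoolP.≟ true) ×-dec (r y ≟ r x) ×-dec ¬? (y Fin.≟ x))
  ...   | yes (y , y∈N , ry=rx , y≢x) = inj₂ (Labelled.partner⇒covers r ℓ (IsRook-swap rook) x y x∈N y∈N ry=rx y≢x)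
  ...   | no no-r-partner with FinP.any? (λ y → (ℓ y ≟ ℓ x) ×-dec ¬? (y Fin.≟ x))
  ...     | yes (y , ℓy=ℓx , y≢x) =
    inj₂ (Labelled.lonely⇒covers-r ℓ r rook x y x∈N ℓy=ℓx y≢x
            (¬true⇒false λ y∈N → no-ℓ-partner (y , y∈N , ℓy=ℓx , y≢x)) (lonely no-ℓ-partner))
  ...     | no no-ℓ-mate =
    inj₁ (Labelled.alone⇒covers-ℓ ℓ r rook x x∈N
            (λ w ℓw=ℓx → decidable-stable (w Fin.≟ x) λ w≢x → no-ℓ-mate (w , ℓw=ℓx , w≢x)) (lonely no-r-partner))

  module TwoClasses (ℓ r : Fin n → ℕ) (rook : IsRook A′ ℓ r)
                    (x : Fin n) (x∈N : N x ≡ true) (covers-x : Covers ℓ x)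
                    (y : Fin n) (y∈N : N y ≡ true) (ℓy≢ℓx : ℓ y ≢ ℓ x)
                    (L : Fin n → ℕ) (L-share⇒adj : ∀ u v → u ≢ v → L u ≡ L v → A′ u v ≡ true)
                    (covers-y : Covers L y) where
    open IsRook rook

    x≁y : A′ x y ≡ false
    x≁y = ¬true⇒false λ xy → ℓy≢ℓx (proj₂ covers-x y y∈N xy)

    x≢y : x ≢ y
    x≢y refl = ℓy≢ℓx refl

    -- a third vertex of N outside the class of x must be adjacent to y, since
    -- otherwise x, y, z would be the leaves of a claw at 0
    N-split : ∀ w → N w ≡ true → ℓ w ≡ ℓ x ⊎ L w ≡ L y
    N-split w w∈N with ℓ w ≟ ℓ x
    ... | yes ℓw=ℓx = inj₁ ℓw=ℓx
    ... | no ℓw≢ℓx with w Fin.≟ y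
    ...   | yes refl = inj₂ refl
    ...   | no w≢y with A′ y w in yw?
    ...     | true = inj₂ (proj₂ covers-y w w∈N yw?)
    ...     | false = ⊥-elim (no-claw zero (suc x) (suc y) (suc w) x∈N y∈N w∈N x≁y yw?
                        (¬true⇒false λ xw → ℓw≢ℓx (proj₂ covers-x w w∈N xw))
                        (suc-≢ x≢y) (suc-≢ (λ eq → w≢y (sym eq))) (suc-≢ (λ eq → ℓw≢ℓx (cong ℓ (sym eq)))))

    -- a vertex in both classes would, by diamond-freeness, make x and y adjacent
    disjoint : ∀ w → ℓ w ≡ ℓ x → L w ≡ L y → ⊥
    disjoint w ℓw=ℓx Lw=Ly with w Fin.≟ y | w Fin.≟ x
    ... | yes refl | _ = ℓy≢ℓx ℓw=ℓx
    ... | no w≢y | yes refl = true≢false (trans (sym (trans (A-sym (suc x) (suc y)) (L-share⇒adj y x (λ eq → w≢y (sym eq)) (sym Lw=Ly)))) x≁y)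
    ... | no w≢y | no w≢x = true≢false (trans (sym xy) x≁y)
      where
      xy : A′ x y ≡ true
      xy = diamond-free zero (suc w) (suc x) (suc y) (proj₁ covers-x w ℓw=ℓx) x∈N (share⇒adj w x w≢x (inj₁ ℓw=ℓx))
                        y∈N (L-share⇒adj w y w≢y Lw=Ly) (suc-≢ x≢y)

    no-edge : ∀ u v → ℓ u ≡ ℓ x → L v ≡ L y → A′ u v ≡ true → ⊥
    no-edge u v ℓu=ℓx Lv=Ly uv = disjoint v (proj₂ covers-x v v∈N xv) Lv=Ly
      where
      v∈N : N v ≡ true
      v∈N = proj₁ covers-y v Lv=Ly
      x≢v : x ≢ v
      x≢v refl = disjoint x refl Lv=Ly
      xv : A′ x v ≡ true
      xv with u Fin.≟ x
      ... | yes refl = uv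
      ... | no u≢x = diamond-free zero (suc u) (suc x) (suc v) (proj₁ covers-x u ℓu=ℓx) x∈N
                       (share⇒adj u x u≢x (inj₁ ℓu=ℓx)) v∈N uv (suc-≢ x≢v)

  -- The data needed to add vertex 0: a rook labelling of H′ together with the
  -- labels (ℓ₀ , r₀) of 0, such that N consists of the vertices sharing one of
  -- them, and no vertex of H′ carries both.
  record Extension : Set where
    field
      ℓ r : Fin n → ℕ
      ℓ₀ r₀ : ℕ
      rook : IsRook A′ ℓ r
      N⇒share : ∀ w → N w ≡ true → ℓ w ≡ ℓ₀ ⊎ r w ≡ r₀
      share⇒N : ∀ w → ℓ w ≡ ℓ₀ ⊎ r w ≡ r₀ → N w ≡ true
      fresh : ∀ w → ℓ w ≡ ℓ₀ → r w ≡ r₀ → ⊥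

  module WithCover (ℓ r : Fin n → ℕ) (rook : IsRook A′ ℓ r) (x : Fin n) (x∈N : N x ≡ true) (covers-x : Covers ℓ x) where
    open IsRook rook

    -- All of N lies in the ℓ-class of x: give 0 a fresh r-label.
    one-class : (∀ w → N w ≡ true → ℓ w ≡ ℓ x) → Extension
    one-class N⊆class = record
      { ℓ = ℓ ; r = r ; ℓ₀ = ℓ x ; r₀ = bound ℓ r ; rook = rook
      ; N⇒share = λ w w∈N → inj₁ (N⊆class w w∈N)
      ; share⇒N = λ { w (inj₁ ℓw=ℓx) → proj₁ covers-x w ℓw=ℓx ; w (inj₂ rw=M) → ⊥-elim (<⇒≢ (r<bound ℓ r w) rw=M) }
      ; fresh = λ w _ rw=M → <⇒≢ (r<bound ℓ r w) rw=M
      }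

    direct : ∀ y → N y ≡ true → ℓ y ≢ ℓ x → Covers r y → Extension
    direct y y∈N ℓy≢ℓx covers-y = record
      { ℓ = ℓ ; r = r ; ℓ₀ = ℓ x ; r₀ = r y ; rook = rook
      ; N⇒share = N-split
      ; share⇒N = λ { w (inj₁ ℓw=ℓx) → proj₁ covers-x w ℓw=ℓx ; w (inj₂ rw=ry) → proj₁ covers-y w rw=ry }
      ; fresh = disjoint
      }
      where open TwoClasses ℓ r rook x x∈N covers-x y y∈N ℓy≢ℓx r (λ u v u≢v ru=rv → share⇒adj u v u≢v (inj₂ ru=rv)) covers-y

    -- Then the
    -- component of y in H′ avoids x (a path from the class of y to the class
    -- of x would close a hole through 0), and after exchanging the coordinates
    -- on that component 0 gets (ℓ x , ℓ y + M).
    module Exchange (y : Fin n) (y∈N : N y ≡ true) (ℓy≢ℓx : ℓ y ≢ ℓ x) (covers-y : Covers ℓ y) where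
      open TwoClasses ℓ r rook x x∈N covers-x y y∈N ℓy≢ℓx ℓ (λ u v u≢v ℓu=ℓv → share⇒adj u v u≢v (inj₁ ℓu=ℓv)) covers-y
      open Component H′ y
      open GraphFacts H′ using (Steps; adj-sym′)

      class-y class-x : Fin n → Bool
      class-y w = ℓ w ≡ᵇ ℓ y
      class-x w = ℓ w ≡ᵇ ℓ x
      open ShortestWalks H′ class-y class-x using (InducedAB; induced-path)

      no-induced-bridge : ∀ m g → InducedAB m g → ⊥
      no-induced-bridge zero g ((start , end , _) , _) = ℓy≢ℓx (trans (sym (≡ᵇ-sound (ℓ (g 0)) _ start)) (≡ᵇ-sound (ℓ (g 0)) _ end))
      no-induced-bridge (suc zero) g ((start , end , steps) , _) =
        no-edge (g 1) (g 0) (≡ᵇ-sound (ℓ (g 1)) _ end) (≡ᵇ-sound (ℓ (g 0)) _ start) (adj-sym′ (steps 0 (s≤s z≤n)))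
      no-induced-bridge (suc (suc m)) g ((start , end , steps) , distinct , chordless , y-only-start , x-only-end) =
        hole-free (suc (suc (suc (suc m)))) (s≤s (s≤s (s≤s (s≤s z≤n))))
          (PathAndApex.induced-cycle (graphOn (suc n) A A-sym A-irrefl) zero (λ i → suc (g i)) (suc (suc m))
             (λ _ _ → 0≢suc) (λ i j i<j j≤ eq → distinct i j i<j j≤ (FinP.suc-injective eq)) steps chordless
             (proj₁ covers-y (g 0) (≡ᵇ-sound (ℓ (g 0)) _ start)) (proj₁ covers-x (g (suc (suc m))) (≡ᵇ-sound (ℓ (g (suc (suc m)))) _ end)) inner)
        where
        -- inner vertices of the path lie in neither class, hence outside N
        inner : ∀ i → 0 < i → i < suc (suc m) → A zero (suc (g i)) ≡ false
        inner i 0<i i< = ¬true⇒false λ gi∈N → case N-split (g i) gi∈N of λ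
          { (inj₁ ℓ=ℓx) → true≢false (trans (sym (≡ᵇ-complete ℓ=ℓx)) (x-only-end i i<))
          ; (inj₂ ℓ=ℓy) → true≢false (trans (sym (≡ᵇ-complete ℓ=ℓy)) (y-only-start i 0<i (<⇒≤ i<))) }

      x∉component : component x ≡ false
      x∉component = ¬true⇒false λ x∈ → bridge (component⇒walk x x∈)
        where
        bridge : (∃ λ m → ∃ λ f → f 0 ≡ y × f m ≡ x × Steps m f) → ⊥
        bridge (m , f , start , end , steps) with induced-path m f
          (subst (λ v → class-y v ≡ true) (sym start) (≡ᵇ-refl (ℓ y)) ,
           subst (λ v → class-x v ≡ true) (sym end) (≡ᵇ-refl (ℓ x)) , steps)
        ... | m′ , g , induced = no-induced-bridge m′ g induced

      class-x-outside : ∀ w → ℓ w ≡ ℓ x → component w ≡ false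
      class-x-outside w ℓw=ℓx with w Fin.≟ x
      ... | yes refl = x∉component
      ... | no w≢x = ¬true⇒false λ w∈ → true≢false
                       (trans (sym (component-closed w x w∈ (share⇒adj w x w≢x (inj₁ ℓw=ℓx)))) x∉component)

      class-y-inside : ∀ w → ℓ w ≡ ℓ y → component w ≡ true
      class-y-inside w ℓw=ℓy with w Fin.≟ y
      ... | yes refl = y∈component
      ... | no w≢y = component-closed y w y∈component (share⇒adj y w (λ eq → w≢y (sym eq)) (inj₁ (sym ℓw=ℓy)))

      open Flip A′ (λ u v → A-sym (suc u) (suc v)) ℓ r rook component component-closed

      inside-or-outside : ∀ w → component w ≡ true ⊎ component w ≡ false
      inside-or-outside w with component w
      ... | true = inj₁ refl
      ... | false = inj₂ refl

      exchanged : Extension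
      exchanged = record
        { ℓ = ℓ′ ; r = r′ ; ℓ₀ = ℓ x ; r₀ = ℓ y + M ; rook = flipped
        ; N⇒share = N⇒share′ ; share⇒N = share⇒N′ ; fresh = fresh′ }
        where
        N⇒share′ : ∀ w → N w ≡ true → ℓ′ w ≡ ℓ x ⊎ r′ w ≡ ℓ y + M
        N⇒share′ w w∈N with N-split w w∈N
        ... | inj₁ ℓw=ℓx = inj₁ (trans (ℓ′-out w (class-x-outside w ℓw=ℓx)) ℓw=ℓx)
        ... | inj₂ ℓw=ℓy = inj₂ (trans (r′-in w (class-y-inside w ℓw=ℓy)) (cong (_+ M) ℓw=ℓy))
        ℓx-not-shifted : ∀ w → component w ≡ true → ℓ′ w ≢ ℓ x
        ℓx-not-shifted w w∈ eq = <⇒≢+ (ℓ x) (r w) M (ℓ<bound ℓ r x) (sym (trans (sym (ℓ′-in w w∈)) eq))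
        r-not-shifted : ∀ w → component w ≡ false → r′ w ≢ ℓ y + M
        r-not-shifted w w∉ eq = <⇒≢+ (r w) (ℓ y) M (r<bound ℓ r w) (trans (sym (r′-out w w∉)) eq)
        share⇒N′ : ∀ w → ℓ′ w ≡ ℓ x ⊎ r′ w ≡ ℓ y + M → N w ≡ true
        share⇒N′ w shared with inside-or-outside w | shared
        ... | inj₁ w∈ | inj₁ eq = ⊥-elim (ℓx-not-shifted w w∈ eq)
        ... | inj₁ w∈ | inj₂ eq = proj₁ covers-y w (+-cancelʳ-≡ M _ _ (trans (sym (r′-in w w∈)) eq))
        ... | inj₂ w∉ | inj₁ eq = proj₁ covers-x w (trans (sym (ℓ′-out w w∉)) eq)
        ... | inj₂ w∉ | inj₂ eq = ⊥-elim (r-not-shifted w w∉ eq)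
        fresh′ : ∀ w → ℓ′ w ≡ ℓ x → r′ w ≡ ℓ y + M → ⊥
        fresh′ w ℓ-eq r-eq with inside-or-outside w
        ... | inj₁ w∈ = ℓx-not-shifted w w∈ ℓ-eq
        ... | inj₂ w∉ = r-not-shifted w w∉ r-eq

    from-cover : Extension
    from-cover with FinP.any? (λ y → (N y BoolP.≟ true) ×-dec ¬? (ℓ y ≟ ℓ x))
    ... | no all-in-class = one-class λ w w∈N → decidable-stable (ℓ w ≟ ℓ x) λ ℓw≢ℓx → all-in-class (w , w∈N , ℓw≢ℓx)
    ... | yes (y , y∈N , ℓy≢ℓx) with covers ℓ r rook y y∈N
    ...   | inj₁ covers-ℓ = Exchange.exchanged y y∈N ℓy≢ℓx covers-ℓ
    ...   | inj₂ covers-r = direct y y∈N ℓy≢ℓx covers-r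

  extension : ∀ ℓ r → IsRook A′ ℓ r → Extension
  extension ℓ r rook with FinP.any? (λ w → N w BoolP.≟ true)
  ... | no N-empty = record
    { ℓ = ℓ ; r = r ; ℓ₀ = bound ℓ r ; r₀ = bound ℓ r ; rook = rook
    ; N⇒share = λ w w∈N → ⊥-elim (N-empty (w , w∈N))
    ; share⇒N = λ { w (inj₁ eq) → ⊥-elim (<⇒≢ (ℓ<bound ℓ r w) eq) ; w (inj₂ eq) → ⊥-elim (<⇒≢ (r<bound ℓ r w) eq) }
    ; fresh = λ w eq _ → <⇒≢ (ℓ<bound ℓ r w) eq
    }
  ... | yes (x , x∈N) with covers ℓ r rook x x∈N
  ...   | inj₁ covers-ℓ = WithCover.from-cover ℓ r rook x x∈N covers-ℓ
  ...   | inj₂ covers-r = WithCover.from-cover r ℓ (IsRook-swap rook) x x∈N covers-r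

  extend : Extension → ∃ λ ℓ → ∃ λ r → IsRook A ℓ r
  extend ext = ℓ⁺ , r⁺ , record { adj⇒share = adj⇒share⁺ ; share⇒adj = share⇒adj⁺ ; injective = injective⁺ }
    where
    open Extension ext
    open IsRook rook
    ℓ⁺ r⁺ : Fin (suc n) → ℕ
    ℓ⁺ zero = ℓ₀
    ℓ⁺ (suc w) = ℓ w
    r⁺ zero = r₀
    r⁺ (suc w) = r w
    sym⊎ : ∀ {a b c d : ℕ} → a ≡ b ⊎ c ≡ d → b ≡ a ⊎ d ≡ c
    sym⊎ = map⊎ sym sym
    adj⇒share⁺ : ∀ u v → A u v ≡ true → ℓ⁺ u ≡ ℓ⁺ v ⊎ r⁺ u ≡ r⁺ v
    adj⇒share⁺ zero zero uv = ⊥-elim (true≢false (trans (sym uv) (A-irrefl zero)))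
    adj⇒share⁺ zero (suc w) uv = sym⊎ (N⇒share w uv)
    adj⇒share⁺ (suc w) zero uv = N⇒share w (trans (A-sym zero (suc w)) uv)
    adj⇒share⁺ (suc u) (suc v) uv = adj⇒share u v uv
    share⇒adj⁺ : ∀ u v → u ≢ v → ℓ⁺ u ≡ ℓ⁺ v ⊎ r⁺ u ≡ r⁺ v → A u v ≡ true
    share⇒adj⁺ zero zero u≢v _ = ⊥-elim (u≢v refl)
    share⇒adj⁺ zero (suc w) _ shared = share⇒N w (sym⊎ shared)
    share⇒adj⁺ (suc w) zero _ shared = trans (A-sym (suc w) zero) (share⇒N w shared)
    share⇒adj⁺ (suc u) (suc v) u≢v shared = share⇒adj u v (λ eq → u≢v (cong suc eq)) shared
    injective⁺ : ∀ u v → ℓ⁺ u ≡ ℓ⁺ v → r⁺ u ≡ r⁺ v → u ≡ v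
    injective⁺ zero zero _ _ = refl
    injective⁺ zero (suc w) ℓ= r= = ⊥-elim (fresh w (sym ℓ=) (sym r=))
    injective⁺ (suc w) zero ℓ= r= = ⊥-elim (fresh w ℓ= r=)
    injective⁺ (suc u) (suc v) ℓ= r= = cong suc (injective u v ℓ= r=)

rook-labelling : ∀ n (A : Fin n → Fin n → Bool) (A-sym : ∀ i j → A i j ≡ A j i) (A-irrefl : ∀ i → A i i ≡ false) →
                 Tame (graphOn n A A-sym A-irrefl) → ∃ λ ℓ → ∃ λ r → IsRook A ℓ r
rook-labelling zero A _ _ _ = (λ ()) , (λ ()) , record { adj⇒share = λ () ; share⇒adj = λ () ; injective = λ () }
rook-labelling (suc n) A A-sym A-irrefl tame
  with rook-labelling n (λ u v → A (suc u) (suc v)) (λ u v → A-sym (suc u) (suc v)) (λ u → A-irrefl (suc u))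
                     (Tame-delete-0 (graphOn (suc n) A A-sym A-irrefl) refl tame)
... | ℓ , r , rook = extend (extension ℓ r rook)
  where open Extension n A A-sym A-irrefl tame

module RookRealisation (H : Graph) (ℓ r : Fin (V H) → ℕ) (rook : IsRook (adj H) ℓ r) where
  open IsRook rook

  M : ℕ
  M = bound ℓ r

  data Node : Set where
    source target : Node
    left right : Fin M → Node

  labelled? : ∀ (i j : Fin M) → Dec (∃ λ v → toℕ i ≡ ℓ v × toℕ j ≡ r v)
  labelled? i j = FinP.any? (λ v → (toℕ i ≟ ℓ v) ×-dec (toℕ j ≟ r v))

  cross-edge : Fin M → Fin M → Bool
  cross-edge i j with labelled? i j
  ... | yes _ = true
  ... | no _ = false

  cross-edge⇒labelled : ∀ i j → cross-edge i j ≡ true → ∃ λ v → toℕ i ≡ ℓ v × toℕ j ≡ r v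
  cross-edge⇒labelled i j e with labelled? i j
  ... | yes labelled = labelled

  labelled⇒cross-edge : ∀ i j v → toℕ i ≡ ℓ v → toℕ j ≡ r v → cross-edge i j ≡ true
  labelled⇒cross-edge i j v ℓ= r= with labelled? i j
  ... | yes _ = refl
  ... | no unlabelled = ⊥-elim (unlabelled (v , ℓ= , r=))

  node-adj : Node → Node → Bool
  node-adj source (left _) = true
  node-adj (left _) source = true
  node-adj target (right _) = true
  node-adj (right _) target = true
  node-adj (left i) (right j) = cross-edge i j
  node-adj (right j) (left i) = cross-edge i j
  node-adj _ _ = false

  node-adj-sym : ∀ x y → node-adj x y ≡ node-adj y x
  node-adj-sym source source = refl
  node-adj-sym source target = refl
  node-adj-sym source (left _) = refl
  node-adj-sym source (right _) = refl
  node-adj-sym target source = refl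
  node-adj-sym target target = refl
  node-adj-sym target (left _) = refl
  node-adj-sym target (right _) = refl
  node-adj-sym (left _) source = refl
  node-adj-sym (left _) target = refl
  node-adj-sym (left _) (left _) = refl
  node-adj-sym (left _) (right _) = refl
  node-adj-sym (right _) source = refl
  node-adj-sym (right _) target = refl
  node-adj-sym (right _) (left _) = refl
  node-adj-sym (right _) (right _) = refl

  node-adj-irrefl : ∀ x → node-adj x x ≡ false
  node-adj-irrefl source = refl
  node-adj-irrefl target = refl
  node-adj-irrefl (left _) = refl
  node-adj-irrefl (right _) = refl

  decode : Fin (suc (suc (M + M))) → Node
  decode zero = source
  decode (suc zero) = target
  decode (suc (suc k)) = Data.Sum.[ left , right ] (Fin.splitAt M k)

  encode : Node → Fin (suc (suc (M + M)))
  encode source = zero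
  encode target = suc zero
  encode (left i) = suc (suc (Fin.join M M (inj₁ i)))
  encode (right j) = suc (suc (Fin.join M M (inj₂ j)))

  decode-encode : ∀ x → decode (encode x) ≡ x
  decode-encode source = refl
  decode-encode target = refl
  decode-encode (left i) rewrite FinP.splitAt-join M M (inj₁ i) = refl
  decode-encode (right j) rewrite FinP.splitAt-join M M (inj₂ j) = refl

  encode-decode : ∀ k → encode (decode k) ≡ k
  encode-decode zero = refl
  encode-decode (suc zero) = refl
  encode-decode (suc (suc k)) with Fin.splitAt M k in split
  ... | inj₁ i = cong (λ m → suc (suc m)) (trans (cong (Fin.join M M) (sym split)) (FinP.join-splitAt M M k))
  ... | inj₂ j = cong (λ m → suc (suc m)) (trans (cong (Fin.join M M) (sym split)) (FinP.join-splitAt M M k))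

  G : Graph
  G = record { V = suc (suc (M + M)) ; adj = λ x y → node-adj (decode x) (decode y)
             ; adj-sym = λ x y → node-adj-sym (decode x) (decode y) ; adj-irrefl = λ x → node-adj-irrefl (decode x) }

  a b : Fin (V G)
  a = encode source
  b = encode target

  open GraphFacts G using (FunWalk; adj-resp)
  open Geodesics G a b

  adj-encode : ∀ x y → adj G (encode x) (encode y) ≡ node-adj x y
  adj-encode x y = cong₂ node-adj (decode-encode x) (decode-encode y)

  ℓ-node r-node : Fin (V H) → Fin M
  ℓ-node v = fromℕ< (ℓ<bound ℓ r v)
  r-node v = fromℕ< (r<bound ℓ r v)

  L R : Fin (V H) → Fin (V G)
  L v = encode (left (ℓ-node v))
  R v = encode (right (r-node v))

  encode-injective : ∀ {x y} → encode x ≡ encode y → x ≡ y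
  encode-injective {x} {y} eq = trans (sym (decode-encode x)) (trans (cong decode eq) (decode-encode y))

  left-injective : ∀ {i j} → left i ≡ left j → i ≡ j
  left-injective refl = refl

  right-injective : ∀ {i j} → right i ≡ right j → i ≡ j
  right-injective refl = refl

  L≡⇔ℓ≡ : ∀ u v → L u ≡ L v ⇔ ℓ u ≡ ℓ v
  L≡⇔ℓ≡ u v = mk⇔ (λ eq → FinP.fromℕ<-injective (ℓ u) (ℓ v) _ _ (left-injective (encode-injective eq)))
                  (λ eq → cong (λ i → encode (left i)) (FinP.fromℕ<-cong (ℓ u) (ℓ v) eq _ _))

  R≡⇔r≡ : ∀ u v → R u ≡ R v ⇔ r u ≡ r v
  R≡⇔r≡ u v = mk⇔ (λ eq → FinP.fromℕ<-injective (r u) (r v) _ _ (right-injective (encode-injective eq)))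
                  (λ eq → cong (λ j → encode (right j)) (FinP.fromℕ<-cong (r u) (r v) eq _ _))

  φ : Fin (V H) → GeoCarrier G
  φ v = 3 , (a ∷ L v ∷ R v ∷ b ∷ [])

  no-common-neighbour : ∀ x → adj G a x ≡ true → adj G x b ≡ true → ⊥
  no-common-neighbour x ax xb with decode x
  ... | left _ = true≢false (sym xb)

  -- a and b are distinct, non-adjacent and without common neighbour, so every
  -- a–b walk has length at least 3
  too-short : ∀ l → l < 3 → ∀ f → ¬ FunWalk a b l f
  too-short zero _ f (start , end , _) with trans (sym start) end
  ... | ()
  too-short (suc zero) _ f (start , end , steps) = true≢false (trans (sym (adj-resp start end (steps 0 (s≤s z≤n)))) refl)
  too-short (suc (suc zero)) _ f (start , end , steps) =
    no-common-neighbour (f 1) (adj-resp {v = f 1} start refl (steps 0 (s≤s z≤n))) (adj-resp {u = f 1} refl end (steps 1 (s≤s (s≤s z≤n))))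
  too-short (suc (suc (suc _))) (s≤s (s≤s (s≤s ())))

  φ-geo : ∀ v → IsGeo (φ v)
  φ-geo v = (refl , refl , (adj-encode source (left (ℓ-node v)) ,
                             (trans (adj-encode (left (ℓ-node v)) (right (r-node v)))
                                    (labelled⇒cross-edge _ _ v (FinP.toℕ-fromℕ< _) (FinP.toℕ-fromℕ< _)) ,
                             (adj-encode (right (r-node v)) target , tt)))) ,
            λ l′ l′<3 w′ walk → too-short l′ l′<3 (toFun w′) (GraphFacts.IsWalk⇒FunWalk G w′ walk)

  φ-injective : ∀ {u v} → φ u ≡ φ v → u ≡ v
  φ-injective {u} {v} eq = injective u v (Equivalence.to (L≡⇔ℓ≡ u v) (cong (λ p → at p 1) eq))
                                         (Equivalence.to (R≡⇔r≡ u v) (cong (λ p → at p 2) eq))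

  ℓ-node-label : ∀ v i → toℕ i ≡ ℓ v → ℓ-node v ≡ i
  ℓ-node-label v i eq = FinP.toℕ-injective (trans (FinP.toℕ-fromℕ< _) (sym eq))

  r-node-label : ∀ v j → toℕ j ≡ r v → r-node v ≡ j
  r-node-label v j eq = FinP.toℕ-injective (trans (FinP.toℕ-fromℕ< _) (sym eq))

  length-3-walk : (w : Vec (Fin (V G)) 4) → IsWalk G a b w → ∃ λ v → φ v ≡ (3 , w)
  length-3-walk (_ ∷ x₁ ∷ x₂ ∷ _ ∷ []) (refl , refl , (ax₁ , (x₁x₂ , (x₂b , _))))
    with decode x₁ in d₁ | decode x₂ in d₂
  ... | left i | right j with cross-edge⇒labelled i j x₁x₂
  ...   | v , ℓ= , r= = v , cong (λ w → 3 , w) (cong₂ (λ p q → a ∷ p ∷ q ∷ b ∷ []) L≡x₁ R≡x₂)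
    where
    L≡x₁ : L v ≡ x₁
    L≡x₁ = trans (cong (λ i → encode (left i)) (ℓ-node-label v i ℓ=)) (trans (cong encode (sym d₁)) (encode-decode x₁))
    R≡x₂ : R v ≡ x₂
    R≡x₂ = trans (cong (λ j → encode (right j)) (r-node-label v j r=)) (trans (cong encode (sym d₂)) (encode-decode x₂))

  source-side : Fin (V G) → Bool
  source-side x with decode x
  ... | source = true
  ... | left _ = true
  ... | _ = false

  crossing⇒vertex : ∀ x y → source-side x ≡ true → source-side y ≡ false → adj G x y ≡ true → Fin (V H)
  crossing⇒vertex x y x-in y-out xy with decode x | decode y
  ... | source | source = ⊥-elim (true≢false y-out)
  ... | source | left _ = ⊥-elim (true≢false y-out)
  ... | left _ | source = ⊥-elim (true≢false y-out)
  ... | left _ | left _ = ⊥-elim (true≢false y-out)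
  ... | left i | right j = proj₁ (cross-edge⇒labelled i j xy)

  -- Every geodesic crosses from the source side to the target side, so it has
  -- the length 3 of the geodesics φ v, and is one of them.
  φ-onto : ∀ l w → IsGeodesic G a b l w → ∃ λ v → φ v ≡ (l , w)
  φ-onto l w geo with GraphFacts.IsWalk⇒FunWalk G w (proj₁ geo)
  ... | start , end , steps with GraphFacts.crossing G source-side l (toFun w) (cong source-side start) (cong source-side end) steps
  ...   | i , i<l , x-in , y-out with same-length (l , w) (φ (crossing⇒vertex (toFun w i) (toFun w (suc i)) x-in y-out (steps i i<l))) geo (φ-geo _)
  ...     | refl = length-3-walk w (proj₁ geo)

  -- Adjacent vertices share one label, so their geodesics differ exactly at
  -- the node of the other label; conversely differing at one node means
  -- sharing the other label.
  adj⇒OneDiff : ∀ u v → adj H u v ≡ true → OneDiff (φ u) (φ v)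
  adj⇒OneDiff u v uv with adj⇒share u v uv
  ... | inj₁ ℓ= = 2 , s≤s (s≤s z≤n) , R-differ , agree
    where
    R-differ : R u ≢ R v
    R-differ eq with injective u v ℓ= (Equivalence.to (R≡⇔r≡ u v) eq)
    ... | refl = true≢false (trans (sym uv) (adj-irrefl H u))
    agree : ∀ j → j ≤ 3 → j ≢ 2 → at (φ u) j ≡ at (φ v) j
    agree zero _ _ = refl
    agree (suc zero) _ _ = Equivalence.from (L≡⇔ℓ≡ u v) ℓ=
    agree (suc (suc zero)) _ j≢2 = ⊥-elim (j≢2 refl)
    agree (suc (suc (suc zero))) _ _ = refl
    agree (suc (suc (suc (suc _)))) (s≤s (s≤s (s≤s ()))) _
  ... | inj₂ r= = 1 , s≤s z≤n , L-differ , agree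
    where
    L-differ : L u ≢ L v
    L-differ eq with injective u v (Equivalence.to (L≡⇔ℓ≡ u v) eq) r=
    ... | refl = true≢false (trans (sym uv) (adj-irrefl H u))
    agree : ∀ j → j ≤ 3 → j ≢ 1 → at (φ u) j ≡ at (φ v) j
    agree zero _ _ = refl
    agree (suc zero) _ j≢1 = ⊥-elim (j≢1 refl)
    agree (suc (suc zero)) _ _ = Equivalence.from (R≡⇔r≡ u v) r=
    agree (suc (suc (suc zero))) _ _ = refl
    agree (suc (suc (suc (suc _)))) (s≤s (s≤s (s≤s ()))) _

  OneDiff⇒adj : ∀ u v → OneDiff (φ u) (φ v) → adj H u v ≡ true
  OneDiff⇒adj u v (zero , _ , differ , _) = ⊥-elim (differ refl)
  OneDiff⇒adj u v (suc zero , _ , differ , agree) =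
    share⇒adj u v (λ eq → differ (cong L eq)) (inj₂ (Equivalence.to (R≡⇔r≡ u v) (agree 2 (s≤s (s≤s z≤n)) (λ ()))))
  OneDiff⇒adj u v (suc (suc zero) , _ , differ , agree) =
    share⇒adj u v (λ eq → differ (cong R eq)) (inj₁ (Equivalence.to (L≡⇔ℓ≡ u v) (agree 1 (s≤s z≤n) (λ ()))))
  OneDiff⇒adj u v (suc (suc (suc zero)) , _ , differ , _) = ⊥-elim (differ refl)
  OneDiff⇒adj u v (suc (suc (suc (suc _))) , s≤s (s≤s (s≤s ())) , _)

  shortest-path-graph : IsSPG H
  shortest-path-graph = G , a , b , (λ ()) , φ , φ-geo , φ-injective , φ-onto , λ u v →
    (λ uv → OneDiff⇒SPGAdj (φ u) (φ v) (φ-geo u) (φ-geo v) (adj⇒OneDiff u v uv)) ,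
    (λ adjacent → OneDiff⇒adj u v (SPGAdj⇒OneDiff (φ u) (φ v) (φ-geo u) (φ-geo v) adjacent))

-- Every clique extends to a maximal clique: scan all vertices, adding each one
-- adjacent to everything chosen so far.  A vertex that was not added has a
-- non-neighbour among the chosen ones, which stays chosen.
module MaximalCliques (H : Graph) where
  open GraphFacts H using (adj-sym′)
  open import Data.List using (List; []; _∷_; allFin)
  open import Data.List.Relation.Unary.Any using (here; there)
  import Data.List.Membership.Propositional as List
  import Data.List.Membership.Propositional.Properties as List

  Joinable : Subset (V H) → Fin (V H) → Set
  Joinable S i = ∀ u → u ∈ S → u ≢ i → adj H i u ≡ true

  joinable? : ∀ S i → Dec (Joinable S i)
  joinable? S i = FinP.all? (λ u → (u ∈? S) →-dec (¬? (u Fin.≟ i) →-dec (adj H i u BoolP.≟ true)))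

  add : Subset (V H) → Fin (V H) → Subset (V H)
  add S i with joinable? S i
  ... | yes _ = S ∪ ⁅ i ⁆
  ... | no _ = S

  scan : Subset (V H) → List (Fin (V H)) → Subset (V H)
  scan S [] = S
  scan S (i ∷ is) = scan (add S i) is

  ⊆-add : ∀ S i → S ⊆ add S i
  ⊆-add S i u∈S with joinable? S i
  ... | yes _ = x∈p∪q⁺ (inj₁ u∈S)
  ... | no _ = u∈S

  ⊆-scan : ∀ S is → S ⊆ scan S is
  ⊆-scan S [] u∈S = u∈S
  ⊆-scan S (i ∷ is) u∈S = ⊆-scan (add S i) is (⊆-add S i u∈S)

  add-clique : ∀ S i → IsClique H S → IsClique H (add S i)
  add-clique S i clique with joinable? S i
  ... | no _ = clique
  ... | yes joinable = λ u v u∈ v∈ u≢v → go u v (x∈p∪q⁻ S ⁅ i ⁆ u∈) (x∈p∪q⁻ S ⁅ i ⁆ v∈) u≢v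
    where
    go : ∀ u v → u ∈ S ⊎ u ∈ ⁅ i ⁆ → v ∈ S ⊎ v ∈ ⁅ i ⁆ → u ≢ v → adj H u v ≡ true
    go u v (inj₁ u∈S) (inj₁ v∈S) u≢v = clique u v u∈S v∈S u≢v
    go u v (inj₂ u∈i) (inj₁ v∈S) u≢v with x∈⁅y⁆⇒x≡y i u∈i
    ... | refl = joinable v v∈S (λ eq → u≢v (sym eq))
    go u v (inj₁ u∈S) (inj₂ v∈i) u≢v with x∈⁅y⁆⇒x≡y i v∈i
    ... | refl = adj-sym′ (joinable u u∈S u≢v)
    go u v (inj₂ u∈i) (inj₂ v∈i) u≢v = ⊥-elim (u≢v (trans (x∈⁅y⁆⇒x≡y i u∈i) (sym (x∈⁅y⁆⇒x≡y i v∈i))))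

  scan-clique : ∀ S is → IsClique H S → IsClique H (scan S is)
  scan-clique S [] clique = clique
  scan-clique S (i ∷ is) clique = scan-clique (add S i) is (add-clique S i clique)

  scanned : ∀ S is w → w List.∈ is → w ∈ scan S is ⊎ ∃ λ u → u ∈ scan S is × adj H w u ≡ false
  scanned S (i ∷ is) w (there w∈is) = scanned (add S i) is w w∈is
  scanned S (i ∷ is) .i (here refl) with joinable? S i
  ... | yes _ = inj₁ (⊆-scan (S ∪ ⁅ i ⁆) is (x∈p∪q⁺ (inj₂ (x∈⁅x⁆ i))))
  ... | no not-joinable with FinP.¬∀⟶∃¬ (V H) _ (λ u → (u ∈? S) →-dec (¬? (u Fin.≟ i) →-dec (adj H i u BoolP.≟ true))) not-joinable
  ...   | u , fails with u ∈? S | u Fin.≟ i | adj H i u BoolP.≟ true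
  ...     | yes u∈S | no _ | no i≁u = inj₂ (u , ⊆-scan S is u∈S , ¬true⇒false i≁u)
  ...     | no u∉S | _ | _ = ⊥-elim (fails (λ u∈S → ⊥-elim (u∉S u∈S)))
  ...     | yes _ | yes u≡i | _ = ⊥-elim (fails (λ _ u≢i → ⊥-elim (u≢i u≡i)))
  ...     | yes _ | no _ | yes iu = ⊥-elim (fails (λ _ _ → iu))

  extend-to-maximal : ∀ S → IsClique H S → ∃ λ T → S ⊆ T × IsMaximalClique H T
  extend-to-maximal S clique = scanned-clique , ⊆-scan S (allFin (V H)) , scan-clique S (allFin (V H)) clique , maximal
    where
    scanned-clique = scan S (allFin (V H))
    maximal : ∀ w → w ∉ scanned-clique → ¬ (∀ u → u ∈ scanned-clique → adj H w u ≡ true)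
    maximal w w∉ joins-all with scanned S (allFin (V H)) w (List.∈-allFin w)
    ... | inj₁ w∈ = w∉ w∈
    ... | inj₂ (u , u∈ , w≁u) = true≢false (trans (sym (joins-all u u∈)) w≁u)

triangle : ∀ (H : Graph) {x y z} → adj H x y ≡ true → adj H x z ≡ true → adj H y z ≡ true →
           IsClique H (⁅ x ⁆ ∪ (⁅ y ⁆ ∪ ⁅ z ⁆))
triangle H {x} {y} {z} xy xz yz s t s∈ t∈ s≢t = go (members s∈) (members t∈)
  where
  open GraphFacts H using (adj-sym′)
  members : ∀ {m} → m ∈ ⁅ x ⁆ ∪ (⁅ y ⁆ ∪ ⁅ z ⁆) → m ≡ x ⊎ m ≡ y ⊎ m ≡ z
  members m∈ with x∈p∪q⁻ ⁅ x ⁆ _ m∈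
  ... | inj₁ m∈x = inj₁ (x∈⁅y⁆⇒x≡y x m∈x)
  ... | inj₂ m∈yz with x∈p∪q⁻ ⁅ y ⁆ ⁅ z ⁆ m∈yz
  ...   | inj₁ m∈y = inj₂ (inj₁ (x∈⁅y⁆⇒x≡y y m∈y))
  ...   | inj₂ m∈z = inj₂ (inj₂ (x∈⁅y⁆⇒x≡y z m∈z))
  go : s ≡ x ⊎ s ≡ y ⊎ s ≡ z → t ≡ x ⊎ t ≡ y ⊎ t ≡ z → adj H s t ≡ true
  go (inj₁ refl) (inj₁ refl) = ⊥-elim (s≢t refl)
  go (inj₁ refl) (inj₂ (inj₁ refl)) = xy
  go (inj₁ refl) (inj₂ (inj₂ refl)) = xz
  go (inj₂ (inj₁ refl)) (inj₁ refl) = adj-sym′ xy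
  go (inj₂ (inj₁ refl)) (inj₂ (inj₁ refl)) = ⊥-elim (s≢t refl)
  go (inj₂ (inj₁ refl)) (inj₂ (inj₂ refl)) = yz
  go (inj₂ (inj₂ refl)) (inj₁ refl) = adj-sym′ xz
  go (inj₂ (inj₂ refl)) (inj₂ (inj₁ refl)) = adj-sym′ yz
  go (inj₂ (inj₂ refl)) (inj₂ (inj₂ refl)) = ⊥-elim (s≢t refl)

-- In a tree of cliques, a diamond p q u w with u ≁ w would put the edge p q into
-- two distinct maximal cliques, through u and through w.
tree-of-cliques⇒diamond-free : ∀ H → TreeOfCliques H → DiamondFree H
tree-of-cliques⇒diamond-free H (_ , _ , cliques-meet) p q u w pq pu qu pw qw u≢w with adj H u w in uw?
... | true = refl
... | false with extend-to-maximal (⁅ p ⁆ ∪ (⁅ q ⁆ ∪ ⁅ u ⁆)) (triangle H pq pu qu)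
               | extend-to-maximal (⁅ p ⁆ ∪ (⁅ q ⁆ ∪ ⁅ w ⁆)) (triangle H pq pw qw)
  where open MaximalCliques H
...   | S , pqu⊆S , max-S | T , pqw⊆T , max-T =
  ⊥-elim (<⇒≱ (two-elements⇒2≤∣p∣ (S ∩ T) (x∈p∩q⁺ (pqu⊆S p∈ , pqw⊆T p∈)) (x∈p∩q⁺ (pqu⊆S q∈ , pqw⊆T q∈)) p≢q)
              (cliques-meet S T max-S max-T S≢T))
  where
  p∈ : ∀ {z} → p ∈ ⁅ p ⁆ ∪ (⁅ q ⁆ ∪ ⁅ z ⁆)
  p∈ = x∈p∪q⁺ (inj₁ (x∈⁅x⁆ p))
  q∈ : ∀ {z} → q ∈ ⁅ p ⁆ ∪ (⁅ q ⁆ ∪ ⁅ z ⁆)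
  q∈ = x∈p∪q⁺ (inj₂ (x∈p∪q⁺ (inj₁ (x∈⁅x⁆ q))))
  z∈ : ∀ z → z ∈ ⁅ p ⁆ ∪ (⁅ q ⁆ ∪ ⁅ z ⁆)
  z∈ z = x∈p∪q⁺ (inj₂ (x∈p∪q⁺ (inj₂ (x∈⁅x⁆ z))))
  p≢q : p ≢ q
  p≢q = GraphFacts.adj⇒≢ H pq
  S≢T : S ≢ T
  S≢T refl = true≢false (trans (sym (proj₁ max-S u w (pqu⊆S (z∈ u)) (pqw⊆T (z∈ w)) u≢w)) uw?)

tree-of-cliques⇒SPG : ∀ H → TreeOfCliques H → IsSPG H
tree-of-cliques⇒SPG H toc@(hole-free , claw-free , _) with rook-labelling (V H) (adj H) (adj-sym H) (adj-irrefl H) tame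
  where
  tame : Tame H
  tame = record { hole-free = hole-free ; no-claw = ClawFree⇒NoClaw H claw-free
                ; diamond-free = tree-of-cliques⇒diamond-free H toc }
... | ℓ , r , rook = RookRealisation.shortest-path-graph H ℓ r rook

theorem15 : (H : Graph) → CkFreeFrom4 H → (IsSPG H ⇔ TreeOfCliques H)
theorem15 H hole-free = mk⇔ (λ { (G , a , b , _ , iso) → FromSPG.tree-of-cliques H G a b iso hole-free })
                            (tree-of-cliques⇒SPG H)
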